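{- Let $n$ be a positive integer and $q=(q_1,\ldots,q_{d-1},n)\in\mathbb{Z}^d$, and set $q_d=1-\sum_{j=1}^{d-1}q_j$. Assume $q_i\mid n$ for all $i=1,\ldots,d$. For a positive integer $m$ let $q^{(m)}=(q_1,\ldots,q_{d-1},mn)$. Then there exist unique polynomials $L_1(x),L_2(x)$ (not depending on $m$) such that $$h^*_{\Delta(0,q^{(m)})}(x)=mx\,L_1(x)+L_2(x)\quad\text{for all positive integers } m,$$ namely $$L_1(x)=\sum_{j=0}^{n-1}x^{\left\lceil\frac{q_1j+q_1^+}{n}\right\rceil+\cdots+\left\lceil\frac{q_dj+q_d^+}{n}\right\rceil-1},\qquad L_2(x)=h^*_{\Delta(0,q)}(x)-\sum_{j=0}^{n-1}x^{\left\lceil\frac{q_1j+q_1^+}{n}\right\rceil+\cdots+\left\lceil\frac{q_dj+q_d^+}{n}\right\rceil}.$$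
   Context: For integer $a$, $a^+=\max(0,a)$. For $p=(p_1,\ldots,p_{d-1},N)\in\mathbb{Z}^d$ with $N\neq0$, $\Delta(0,p)=\mathrm{conv}\{\mathbf{0},\mathbf{e}_1,\ldots,\mathbf{e}_{d-1},N\mathbf{e}_d+\sum_{i=1}^{d-1}p_i\mathbf{e}_i\}\subset\mathbb{R}^d$, where $\mathbf{e}_i$ are the unit coordinate vectors and $\mathbf{0}$ the origin. For a $d$-dimensional integral polytope $\mathcal{P}$ with Ehrhart polynomial $i(\mathcal{P},t)=\#(t\mathcal{P}\cap\mathbb{Z}^d)$, the $h^*$-polynomial is defined by $1+\sum_{t\geq1}i(\mathcal{P},t)x^t=h^*_{\mathcal{P}}(x)/(1-x)^{d+1}$. -}

module Defs where

open import Data.Nat as ℕ using (ℕ; zero; suc; NonZero)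
open import Data.Nat.Combinatorics using (_C_)
open import Data.Integer as ℤ using (ℤ; +_; -[1+_]; _⊔_)
open import Data.Rational as ℚ using (ℚ; ceiling)
open import Data.Fin using (Fin; zero; suc; toℕ)
open import Data.Vec as Vec using (Vec; _∷ʳ_; tabulate; replicate; lookup)
open import Data.List using (List; length)
open import Data.List.Membership.Propositional using (_∈_)
open import Data.List.Relation.Unary.Unique.Propositional using (Unique)
open import Data.Product using (Σ; _×_; ∃)
open import Data.Bool using (if_then_else_)
open import Relation.Nullary using (does)
open import Relation.Binary.PropositionalEquality using (_≡_)
open import Function.Bundles using (_⇔_)

_⁺ : ℤ → ℤ
a ⁺ = a ⊔ + 0

sumFinℚ : ∀ {k} → (Fin k → ℚ) → ℚ
sumFinℚ {zero} f = ℚ.0ℚ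
sumFinℚ {suc k} f = f zero ℚ.+ sumFinℚ (λ i → f (suc i))

sumVecℤ : ∀ {k} → Vec ℤ k → ℤ
sumVecℤ = Vec.foldr _ ℤ._+_ (+ 0)

sumTo : ℕ → (ℕ → ℤ) → ℤ
sumTo zero f = + 0
sumTo (suc k) f = sumTo k f ℤ.+ f k

toℚ : ℤ → ℚ
toℚ a = a ℚ./ 1

-- Points of ℤ^d, d = suc d', as vectors.
-- Vertices of Δ(0,p) for p = (p₁,…,p_{d-1},N): index 0 ↦ origin,
-- index 1 ↦ N e_d + Σ p_i e_i, index 2+i ↦ e_{i+1} (i < d-1).
unitVec : ∀ {d'} → Fin d' → Vec ℤ (suc d')
unitVec {d'} i = tabulate (λ k → if does (toℕ k ℕ.≟ toℕ i) then + 1 else + 0)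

vertΔ : ∀ {d'} → Vec ℤ d' → ℤ → Fin (suc (suc d')) → Vec ℤ (suc d')
vertΔ {d'} p N zero = replicate (suc d') (+ 0)
vertΔ p N (suc zero) = p ∷ʳ N
vertΔ p N (suc (suc i)) = unitVec i

-- x ∈ t · conv{V 0,…,V k}: x = Σ λ_i V_i with λ_i ≥ 0 rational, Σ λ_i = t.
InDilate : ∀ {k d} → ℕ → (Fin k → Vec ℤ d) → Vec ℤ d → Set
InDilate {k} {d} t V x =
  Σ (Fin k → ℚ) λ lam →
    (∀ i → ℚ.0ℚ ℚ.≤ lam i) ×
    (sumFinℚ lam ≡ toℚ (+ t)) ×
    (∀ (j : Fin d) → toℚ (lookup x j) ≡ sumFinℚ (λ i → lam i ℚ.* toℚ (lookup (V i) j)))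

LatticeCount : ∀ {d} → (Vec ℤ d → Set) → ℕ → Set
LatticeCount {d} P c =
  Σ (List (Vec ℤ d)) λ xs → Unique xs × (length xs ≡ c) × (∀ x → (x ∈ xs) ⇔ P x)

-- E t = i(P,t) for t ≥ 1; the Ehrhart series is 1 + Σ_{t≥1} E t x^t.
ehrSeq : (ℕ → ℕ) → ℕ → ℤ
ehrSeq E zero = + 1
ehrSeq E (suc t) = + E (suc t)

-- coefficient of x^k (k ∈ ℤ) in (1-x)^{dim+1} · (1 + Σ_{t≥1} E t x^t);
-- by definition this is h*(x).
sgn : ℕ → ℤ
sgn zero = + 1
sgn (suc j) = ℤ.- sgn j

hstarCoeff : ℕ → (ℕ → ℕ) → ℤ → ℤ
hstarCoeff dim E (+ k) = sumTo (suc k) (λ j → sgn j ℤ.* + (suc dim C j) ℤ.* ehrSeq E (k ℕ.∸ j))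
hstarCoeff dim E -[1+ k ] = + 0

ceilDiv : ℤ → (n : ℕ) → .{{NonZero n}} → ℤ
ceilDiv a n = ceiling (a ℚ./ n)

-- coefficient of x^k in Σ_{j=0}^{n-1} x^{e j} (Laurent polynomial, exponents in ℤ)
monoSumCoeff : ℕ → (ℕ → ℤ) → ℤ → ℤ
monoSumCoeff n e k = sumTo n (λ j → if does (e j ℤ.≟ k) then + 1 else + 0)

qFull : ∀ {d'} → Vec ℤ d' → Vec ℤ (suc d')
qFull q = q ∷ʳ (+ 1 ℤ.- sumVecℤ q)

expo : ∀ {d'} → Vec ℤ d' → (n : ℕ) → .{{NonZero n}} → ℕ → ℤ
expo q n j = sumVecℤ (Vec.map (λ qi → ceilDiv (qi ℤ.* + j ℤ.+ qi ⁺) n) (qFull q))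

L₁ : ∀ {d'} → Vec ℤ d' → (n : ℕ) → .{{NonZero n}} → ℤ → ℤ
L₁ q n = monoSumCoeff n (λ j → expo q n j ℤ.- + 1)

L₂ : ∀ {d'} → Vec ℤ d' → (n : ℕ) → .{{NonZero n}} → (hq : ℤ → ℤ) → ℤ → ℤ
L₂ q n hq k = hq k ℤ.- monoSumCoeff n (expo q n) k

-- coefficient of x^k in m·x·A(x) + B(x)
mxAplusB : ℕ → (ℤ → ℤ) → (ℤ → ℤ) → ℤ → ℤ
mxAplusB m A B k = + m ℤ.* A (k ℤ.- + 1) ℤ.+ B k

FinSupp : (ℤ → ℤ) → Set
FinSupp A = ∃ λ (B : ℕ) → ∀ k → B ℕ.< ℤ.∣ k ∣ → A k ≡ + 0

Poly : (ℤ → ℤ) → Set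
Poly A = FinSupp A × (∀ k → k ℤ.< + 0 → A k ≡ + 0)

{-# OPTIONS --safe #-}
module Submission where

-- Write a lattice point of t·Δ(0,p), p = (p₁,…,p_D,N), as (x,s) with s its last coordinate. Its
-- barycentric coordinates are s/N, (N xᵢ − pᵢ s)/N and (N (t − Σx) − q_d s)/N with q_d = 1 − Σp, so
-- the points at height s are x = ⌈p s/N⌉ + y with y ∈ ℕ^D and Σy ≤ t − w(s), where w(s) = Σᵢ ⌈qᵢ s/N⌉
-- over q = (p₁,…,p_D,q_d). Hence i(t) = Σ_{s≤tN} C(t − w(s) + D, D). The d + 1 differences hidden in
-- (1 − x)^{d+1} turn the s-th term into [t = w(s)] − [t = w(s) + 1], and since Σqᵢ = 1 gives
-- w(s + N) = w(s) + 1, these telescope to h*(x) = Σ_{s<N} x^{w(s)}.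
-- For q⁽ᵐ⁾ the apex height is mn; write s = jm + b. For b = 0 the weight is that of q at j, and for
-- 0 < b < m the hypothesis qᵢ ∣ n forces ⌈qᵢ(jm + b)/(mn)⌉ = ⌈(qᵢ j + qᵢ⁺)/n⌉. So every residue j
-- contributes x^{w(j)} once and x^{e(j)}, e(j) = Σᵢ ⌈(qᵢ j + qᵢ⁺)/n⌉, m − 1 times: h* = m·x·L₁ + L₂.
-- Comparing m = 1 and m = 2 determines L₁ and L₂.

open import Algebra.Bundles using (AbelianGroup)
open import Data.Bool using (if_then_else_)
open import Data.Fin using (Fin; zero; suc; toℕ; inject₁; fromℕ)
import Data.Fin.Properties as Fin
open import Data.Integer as ℤ using (ℤ; +_; -[1+_]; _+_; _-_; _*_; -_; _≤_; _<_; ∣_∣)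
import Data.Integer.DivMod as ℤ
open import Data.Integer.Divisibility using (_∣_)
import Data.Integer.Properties as ℤ
open import Data.Integer.Tactic.RingSolver using (solve-∀)
open import Data.List as List using (List; []; _∷_; _++_; length)
open import Data.List.Membership.Propositional using (_∈_)
open import Data.List.Membership.Propositional.Properties using (∈-++⁺ˡ; ∈-++⁺ʳ; ∈-++⁻; ∈-map⁺; ∈-map⁻)
open import Data.List.Membership.Propositional.Properties.WithK using (unique∧set⇒bag)
import Data.List.Properties as List
open import Data.List.Relation.Binary.BagAndSetEquality using (∼bag⇒↭)
open import Data.List.Relation.Binary.Permutation.Propositional.Properties using (↭-length)
import Data.List.Relation.Unary.All as All
open import Data.List.Relation.Unary.AllPairs using ([]; _∷_)
open import Data.List.Relation.Unary.Any using (here)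
open import Data.List.Relation.Unary.Unique.Propositional using (Unique)
open import Data.List.Relation.Unary.Unique.Propositional.Properties using (++⁺; map⁺)
open import Data.Nat as ℕ using (ℕ; zero; suc; NonZero)
open import Data.Nat.Combinatorics using (_C_; nCk+nC[k+1]≡[n+1]C[k+1])
import Data.Nat.Coprimality as ℕ
import Data.Nat.Divisibility as ℕ
import Data.Nat.GCD as ℕ
import Data.Nat.Properties as ℕ
open import Data.Product using (Σ; _×_; _,_; proj₁; proj₂)
open import Data.Rational as ℚ using (ℚ; mkℚ; ↥_; ↧_; ceiling)
import Data.Rational.Properties as ℚ
open import Data.Sum using (inj₁; inj₂)
open import Data.Vec as Vec using (Vec; []; _∷_; _∷ʳ_; lookup)
import Data.Vec.Properties as Vec
open import Function.Bundles using (_⇔_; mk⇔; Equivalence)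
import Function.Properties.Equivalence as ⇔
open import Level using (0ℓ)
open import Relation.Binary.Definitions using (tri<; tri≈; tri>)
open import Relation.Binary.PropositionalEquality
import Relation.Binary.Reasoning.Setoid as SetoidReasoning
open import Relation.Nullary using (¬_; contradiction; does)
open import Relation.Nullary.Decidable using (yes; no; dec⇒maybe; dec-true; dec-false)
open import Tactic.RingSolver using () renaming (solve-∀ to solve-∀-in)
import Tactic.RingSolver.Core.AlmostCommutativeRing as ACR

open import Defs
open import Algebra.Properties.Group (AbelianGroup.group ℤ.+-0-abelianGroup) using () renaming (∙-cancelʳ to +-cancelʳ)

module ⇔-Reasoning = SetoidReasoning (⇔.⇔-setoid 0ℓ)

≡⇒⇔ : ∀ {A B : Set} → A ≡ B → A ⇔ B
≡⇒⇔ refl = ⇔.refl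

i<j+1⇒i≤j : ∀ {i j} → i < j + + 1 → i ≤ j
i<j+1⇒i≤j {i} {j} i<j+1 =
  subst (i ≤_) (trans (cong ℤ.pred (ℤ.+-comm j (+ 1))) (ℤ.pred-suc j)) (ℤ.i<j⇒i≤pred[j] i<j+1)

1+i≤j⇔i<j : ∀ {i j} → + 1 + i ≤ j ⇔ i < j
1+i≤j⇔i<j = mk⇔ ℤ.suc[i]≤j⇒i<j ℤ.i<j⇒suc[i]≤j

i<j⇒i-j<0 : ∀ {i j} → i < j → i - j < + 0
i<j⇒i-j<0 {i} {j} i<j = subst (i - j <_) (ℤ.+-inverseʳ j) (ℤ.+-monoˡ-< (- j) i<j)

neg-≤⇔ : ∀ {i j} → - i ≤ - j ⇔ j ≤ i
neg-≤⇔ = mk⇔ ℤ.neg-cancel-≤ ℤ.neg-mono-≤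

+-cancelʳ-≤⇔ : ∀ k {i j} → i + k ≤ j + k ⇔ i ≤ j
+-cancelʳ-≤⇔ k {i} {j} = mk⇔ (λ i+k≤j+k → subst₂ _≤_ (lemma i k) (lemma j k) (ℤ.+-monoˡ-≤ (- k) i+k≤j+k)) (ℤ.+-monoˡ-≤ k)
  where lemma : ∀ i k → i + k + - k ≡ i
        lemma = solve-∀

i≤j-k⇔i+k≤j : ∀ {i j k} → i ≤ j - k ⇔ i + k ≤ j
i≤j-k⇔i+k≤j {i} {j} {k} = ⇔.trans (⇔.sym (+-cancelʳ-≤⇔ k)) (≡⇒⇔ (cong (i + k ≤_) (lemma j k)))
  where lemma : ∀ j k → j - k + k ≡ j
        lemma = solve-∀

*-cancelˡ-≤⇔ : ∀ n .{{_ : NonZero n}} {i j} → + n * i ≤ + n * j ⇔ i ≤ j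
*-cancelˡ-≤⇔ zero            = contradiction refl (ℕ.≢-nonZero⁻¹ zero)
*-cancelˡ-≤⇔ (suc k) {i} {j} = mk⇔ (ℤ.*-cancelˡ-≤-pos i j (+ suc k)) (ℤ.*-monoˡ-≤-nonNeg (+ suc k))

*-cancelʳ-≤⇔ : ∀ n .{{_ : NonZero n}} {i j} → i * + n ≤ j * + n ⇔ i ≤ j
*-cancelʳ-≤⇔ n {i} {j} = ⇔.trans (≡⇒⇔ (cong₂ _≤_ (ℤ.*-comm i (+ n)) (ℤ.*-comm j (+ n)))) (*-cancelˡ-≤⇔ n)

pos-*-+ : ∀ j m b → + (j ℕ.* m ℕ.+ b) ≡ + j * + m + + b
pos-*-+ j m b = trans (ℤ.pos-+ (j ℕ.* m) b) (cong (_+ + b) (ℤ.pos-* j m))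

module _ {m b : ℕ} (0<b : 0 ℕ.< b) (b<m : b ℕ.< m) where
  open ℤ.≤-Reasoning

  j*m+b≤m*y⇔j<y : ∀ j y → j * + m + + b ≤ + m * y ⇔ j < y
  j*m+b≤m*y⇔j<y j y = mk⇔ to from
    where
    to : j * + m + + b ≤ + m * y → j < y
    to h = ℤ.*-cancelˡ-<-nonNeg (+ m) (begin-strict
      + m * j         ≡⟨ lemma (+ m) j ⟩
      j * + m + + 0   <⟨ ℤ.+-monoʳ-< (j * + m) (ℤ.+<+ 0<b) ⟩
      j * + m + + b   ≤⟨ h ⟩
      + m * y         ∎)
      where lemma : ∀ m j → m * j ≡ j * m + + 0
            lemma = solve-∀
    from : j < y → j * + m + + b ≤ + m * y
    from j<y = begin
      j * + m + + b   ≤⟨ ℤ.+-monoʳ-≤ (j * + m) (ℤ.+≤+ (ℕ.<⇒≤ b<m)) ⟩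
      j * + m + + m   ≡⟨ lemma (+ m) j ⟩
      + m * (+ 1 + j) ≤⟨ ℤ.*-monoˡ-≤-nonNeg (+ m) (ℤ.i<j⇒suc[i]≤j j<y) ⟩
      + m * y         ∎
      where lemma : ∀ m j → j * m + m ≡ m * (+ 1 + j)
            lemma = solve-∀

  -[j*m+b]≤m*y⇔-j≤y : ∀ j y → - (j * + m + + b) ≤ + m * y ⇔ - j ≤ y
  -[j*m+b]≤m*y⇔-j≤y j y = mk⇔ to from
    where
    to : - (j * + m + + b) ≤ + m * y → - j ≤ y
    to h = i<j+1⇒i≤j (ℤ.*-cancelˡ-<-nonNeg (+ m) (begin-strict
      + m * - j                ≡⟨ lemma₁ (+ m) j (+ b) ⟩
      - (j * + m + + b) + + b  ≤⟨ ℤ.+-monoˡ-≤ (+ b) h ⟩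
      + m * y + + b            <⟨ ℤ.+-monoʳ-< (+ m * y) (ℤ.+<+ b<m) ⟩
      + m * y + + m            ≡⟨ lemma₂ (+ m) y ⟩
      + m * (y + + 1)          ∎))
      where lemma₁ : ∀ m j b → m * - j ≡ - (j * m + b) + b
            lemma₁ = solve-∀
            lemma₂ : ∀ m y → m * y + m ≡ m * (y + + 1)
            lemma₂ = solve-∀
    from : - j ≤ y → - (j * + m + + b) ≤ + m * y
    from -j≤y = begin
      - (j * + m + + b)  ≤⟨ ℤ.neg-mono-≤ (ℤ.i≤i+j (j * + m) (+ b)) ⟩
      - (j * + m)        ≡⟨ lemma (+ m) j ⟩
      + m * - j          ≤⟨ ℤ.*-monoˡ-≤-nonNeg (+ m) -j≤y ⟩
      + m * y            ∎
      where lemma : ∀ m j → - (j * m) ≡ m * - j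
            lemma = solve-∀

module _ {n k Q : ℕ} (n≡k*Q : n ≡ k ℕ.* Q) where

  +n*x≡Q*[k*x] : ∀ x → + n * x ≡ + Q * (+ k * x)
  +n*x≡Q*[k*x] x = trans (cong (λ n → + n * x) n≡k*Q) (trans (cong (_* x) (ℤ.pos-* k Q)) (lemma (+ k) (+ Q) x))
    where lemma : ∀ k Q x → k * Q * x ≡ Q * (k * x)
          lemma = solve-∀

  +[m*n]*x≡Q*[m*[k*x]] : ∀ m x → + (m ℕ.* n) * x ≡ + Q * (+ m * (+ k * x))
  +[m*n]*x≡Q*[m*[k*x]] m x = trans (cong (_* x) (ℤ.pos-* m n)) (trans (ℤ.*-assoc (+ m) (+ n) x)
    (trans (cong (+ m *_) (+n*x≡Q*[k*x] x)) (lemma (+ m) (+ Q) (+ k * x))))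
    where lemma : ∀ m Q y → m * (Q * y) ≡ Q * (m * y)
          lemma = solve-∀

≗⇒≡ : ∀ {A : Set} {n} {u v : Vec A n} → (∀ i → lookup u i ≡ lookup v i) → u ≡ v
≗⇒≡ {u = u} {v} e = trans (sym (Vec.tabulate∘lookup u)) (trans (Vec.tabulate-cong e) (Vec.tabulate∘lookup v))

module _ {A : Set} where

  map-cong-lookup : ∀ {B : Set} {n} {f g : A → B} (v : Vec A n) →
    (∀ i → f (lookup v i) ≡ g (lookup v i)) → Vec.map f v ≡ Vec.map g v
  map-cong-lookup []      _ = refl
  map-cong-lookup (x ∷ v) e = cong₂ _∷_ (e zero) (map-cong-lookup v (λ i → e (suc i)))

  lookup-∷ʳ-inject₁ : ∀ {k} (v : Vec A k) a i → lookup (v ∷ʳ a) (inject₁ i) ≡ lookup v i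
  lookup-∷ʳ-inject₁ (x ∷ v) a zero    = refl
  lookup-∷ʳ-inject₁ (x ∷ v) a (suc i) = lookup-∷ʳ-inject₁ v a i

  lookup-∷ʳ-fromℕ : ∀ {k} (v : Vec A k) a → lookup (v ∷ʳ a) (fromℕ k) ≡ a
  lookup-∷ʳ-fromℕ []      a = refl
  lookup-∷ʳ-fromℕ (x ∷ v) a = lookup-∷ʳ-fromℕ v a

data InitOrLast {k} : Fin (suc k) → Set where
  init : ∀ i → InitOrLast (inject₁ i)
  last : InitOrLast (fromℕ k)

initOrLast : ∀ {k} (j : Fin (suc k)) → InitOrLast j
initOrLast {zero}  zero    = last
initOrLast {suc k} zero    = init zero
initOrLast {suc k} (suc j) with initOrLast j
... | init i = init (suc i)
... | last   = last

sumVecℤ-∷ʳ : ∀ {n} (v : Vec ℤ n) a → sumVecℤ (v ∷ʳ a) ≡ sumVecℤ v + a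
sumVecℤ-∷ʳ []      a = ℤ.+-comm a (+ 0)
sumVecℤ-∷ʳ (x ∷ v) a = trans (cong (_+_ x) (sumVecℤ-∷ʳ v a)) (sym (ℤ.+-assoc x _ a))

sumVecℤ-qFull : ∀ {n} (p : Vec ℤ n) → sumVecℤ (qFull p) ≡ + 1
sumVecℤ-qFull p = trans (sumVecℤ-∷ʳ p _) (lemma (sumVecℤ p))
  where lemma : ∀ a → a + (+ 1 - a) ≡ + 1
        lemma = solve-∀

sumVecℤ-zipWith-+ : ∀ {n} (u v : Vec ℤ n) → sumVecℤ (Vec.zipWith _+_ u v) ≡ sumVecℤ u + sumVecℤ v
sumVecℤ-zipWith-+ []      []      = refl
sumVecℤ-zipWith-+ (a ∷ u) (b ∷ v) = trans (cong (_+_ (a + b)) (sumVecℤ-zipWith-+ u v)) (lemma a b _ _)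
  where lemma : ∀ a b c d → a + b + (c + d) ≡ a + c + (b + d)
        lemma = solve-∀

sumVecℤ-map-pos : ∀ {n} (y : Vec ℕ n) → sumVecℤ (Vec.map +_ y) ≡ + Vec.sum y
sumVecℤ-map-pos []      = refl
sumVecℤ-map-pos (a ∷ y) = trans (cong (_+_ (+ a)) (sumVecℤ-map-pos y)) (sym (ℤ.pos-+ a (Vec.sum y)))

module _ {A : Set} where

  sumVecℤ-map-+ : ∀ {n} (f g : A → ℤ) (v : Vec A n) →
    sumVecℤ (Vec.map (λ x → f x + g x) v) ≡ sumVecℤ (Vec.map f v) + sumVecℤ (Vec.map g v)
  sumVecℤ-map-+ f g []      = refl
  sumVecℤ-map-+ f g (x ∷ v) = trans (cong (_+_ (f x + g x)) (sumVecℤ-map-+ f g v)) (lemma (f x) (g x) _ _)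
    where lemma : ∀ a b c d → a + b + (c + d) ≡ a + c + (b + d)
          lemma = solve-∀

  sumVecℤ-map-*ˡ : ∀ {n} c (f : A → ℤ) (v : Vec A n) →
    sumVecℤ (Vec.map (λ x → c * f x) v) ≡ c * sumVecℤ (Vec.map f v)
  sumVecℤ-map-*ˡ c f []      = sym (ℤ.*-zeroʳ c)
  sumVecℤ-map-*ˡ c f (x ∷ v) = trans (cong (_+_ (c * f x)) (sumVecℤ-map-*ˡ c f v)) (sym (ℤ.*-distribˡ-+ c (f x) _))

  sumVecℤ-map-mono-≤ : ∀ {n} {f g : A → ℤ} → (∀ x → f x ≤ g x) → (v : Vec A n) →
    sumVecℤ (Vec.map f v) ≤ sumVecℤ (Vec.map g v)
  sumVecℤ-map-mono-≤ f≤g []      = ℤ.≤-refl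
  sumVecℤ-map-mono-≤ f≤g (x ∷ v) = ℤ.+-mono-≤ (f≤g x) (sumVecℤ-map-mono-≤ f≤g v)

  sumVecℤ-map-≗0 : ∀ {n} {f : A → ℤ} → (∀ x → f x ≡ + 0) → (v : Vec A n) → sumVecℤ (Vec.map f v) ≡ + 0
  sumVecℤ-map-≗0 f≗0 []      = refl
  sumVecℤ-map-≗0 f≗0 (x ∷ v) = cong₂ _+_ (f≗0 x) (sumVecℤ-map-≗0 f≗0 v)

sumTo-cong : ∀ c {f g : ℕ → ℤ} → (∀ i → i ℕ.< c → f i ≡ g i) → sumTo c f ≡ sumTo c g
sumTo-cong zero    e = refl
sumTo-cong (suc c) e = cong₂ _+_ (sumTo-cong c (λ i i<c → e i (ℕ.m<n⇒m<1+n i<c))) (e c ℕ.≤-refl)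

sumTo-≗0 : ∀ c {f : ℕ → ℤ} → (∀ i → i ℕ.< c → f i ≡ + 0) → sumTo c f ≡ + 0
sumTo-≗0 zero    f≗0 = refl
sumTo-≗0 (suc c) f≗0 = cong₂ _+_ (sumTo-≗0 c (λ i i<c → f≗0 i (ℕ.m<n⇒m<1+n i<c))) (f≗0 c ℕ.≤-refl)

sumTo-shift : ∀ k (f : ℕ → ℤ) → sumTo (suc k) f ≡ f 0 + sumTo k (λ j → f (suc j))
sumTo-shift zero    f = ℤ.+-comm (+ 0) (f 0)
sumTo-shift (suc k) f = trans (cong (_+ f (suc k)) (sumTo-shift k f)) (ℤ.+-assoc (f 0) _ _)

sumTo-+-distrib : ∀ c (f g : ℕ → ℤ) → sumTo c (λ i → f i + g i) ≡ sumTo c f + sumTo c g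
sumTo-+-distrib zero    f g = refl
sumTo-+-distrib (suc c) f g = trans (cong (_+ (f c + g c)) (sumTo-+-distrib c f g)) (lemma (sumTo c f) (sumTo c g) (f c) (g c))
  where lemma : ∀ a b x y → a + b + (x + y) ≡ a + x + (b + y)
        lemma = solve-∀

sumTo-sub : ∀ c (f g : ℕ → ℤ) → sumTo c (λ i → f i - g i) ≡ sumTo c f - sumTo c g
sumTo-sub zero    f g = refl
sumTo-sub (suc c) f g = trans (cong (_+ (f c - g c)) (sumTo-sub c f g)) (lemma (sumTo c f) (sumTo c g) (f c) (g c))
  where lemma : ∀ a b x y → a - b + (x - y) ≡ a + x - (b + y)
        lemma = solve-∀

sumTo-*ˡ : ∀ c a (f : ℕ → ℤ) → sumTo c (λ i → a * f i) ≡ a * sumTo c f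
sumTo-*ˡ zero    a f = sym (ℤ.*-zeroʳ a)
sumTo-*ˡ (suc c) a f = trans (cong (_+ a * f c) (sumTo-*ˡ c a f)) (sym (ℤ.*-distribˡ-+ a (sumTo c f) (f c)))

sumTo-const : ∀ c x → sumTo c (λ _ → x) ≡ + c * x
sumTo-const zero    x = sym (ℤ.*-zeroˡ x)
sumTo-const (suc c) x = trans (cong (_+ x) (sumTo-const c x)) (lemma (+ c) x)
  where lemma : ∀ c x → c * x + x ≡ (+ 1 + c) * x
        lemma = solve-∀

sumTo-+ : ∀ c e (f : ℕ → ℤ) → sumTo (c ℕ.+ e) f ≡ sumTo c f + sumTo e (λ i → f (c ℕ.+ i))
sumTo-+ c zero    f = trans (cong (λ n → sumTo n f) (ℕ.+-identityʳ c)) (sym (ℤ.+-identityʳ _))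
sumTo-+ c (suc e) f = trans (cong (λ n → sumTo n f) (ℕ.+-suc c e))
  (trans (cong (_+ f (c ℕ.+ e)) (sumTo-+ c e f)) (ℤ.+-assoc (sumTo c f) _ _))

sumTo-* : ∀ n m (f : ℕ → ℤ) → sumTo (n ℕ.* m) f ≡ sumTo n (λ j → sumTo m (λ b → f (j ℕ.* m ℕ.+ b)))
sumTo-* zero    m f = refl
sumTo-* (suc n) m f = trans (cong (λ c → sumTo c f) (ℕ.+-comm m (n ℕ.* m)))
  (trans (sumTo-+ (n ℕ.* m) m f) (cong (_+ sumTo m (λ b → f (n ℕ.* m ℕ.+ b))) (sumTo-* n m f)))

sumTo-extend : ∀ {c d} (f : ℕ → ℤ) → c ℕ.≤ d → (∀ i → c ℕ.≤ i → i ℕ.< d → f i ≡ + 0) → sumTo c f ≡ sumTo d f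
sumTo-extend {c} {d} f c≤d vanish = sym (begin
  sumTo d f                                        ≡⟨ cong (λ n → sumTo n f) (ℕ.m+[n∸m]≡n c≤d) ⟨
  sumTo (c ℕ.+ (d ℕ.∸ c)) f                        ≡⟨ sumTo-+ c (d ℕ.∸ c) f ⟩
  sumTo c f + sumTo (d ℕ.∸ c) (λ i → f (c ℕ.+ i))  ≡⟨ cong (_+_ (sumTo c f)) (sumTo-≗0 (d ℕ.∸ c) tail≡0) ⟩
  sumTo c f + + 0                                  ≡⟨ ℤ.+-identityʳ _ ⟩
  sumTo c f                                        ∎)
  where
  open ≡-Reasoning
  tail≡0 : ∀ i → i ℕ.< d ℕ.∸ c → f (c ℕ.+ i) ≡ + 0
  tail≡0 i i<d∸c = vanish (c ℕ.+ i) (ℕ.m≤m+n c i) (subst (c ℕ.+ i ℕ.<_) (ℕ.m+[n∸m]≡n c≤d) (ℕ.+-monoʳ-< c i<d∸c))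

-- Ceiling division

i≤j/k⇔i*k≤j : ∀ i j k → i ≤ j ℤ./ + suc k ⇔ i * + suc k ≤ j
i≤j/k⇔i*k≤j i j k = mk⇔ to from
  where
  d : ℤ
  d = + suc k
  open ℤ.≤-Reasoning
  division : j ≡ + (j ℤ.% d) + (j ℤ./ d) * d
  division = ℤ.a≡a%n+[a/n]*n j d
  to : i ≤ j ℤ./ d → i * d ≤ j
  to i≤j/d = begin
    i * d                       ≤⟨ ℤ.*-monoʳ-≤-nonNeg d i≤j/d ⟩
    (j ℤ./ d) * d               ≤⟨ ℤ.i≤j+i _ (+ (j ℤ.% d)) ⟩
    + (j ℤ.% d) + (j ℤ./ d) * d ≡⟨ division ⟨
    j                           ∎
  from : i * d ≤ j → i ≤ j ℤ./ d
  from i*d≤j = i<j+1⇒i≤j (ℤ.*-cancelʳ-<-nonNeg d (begin-strict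
    i * d                       ≤⟨ i*d≤j ⟩
    j                           ≡⟨ division ⟩
    + (j ℤ.% d) + (j ℤ./ d) * d <⟨ ℤ.+-monoˡ-< ((j ℤ./ d) * d) (ℤ.+<+ (ℤ.n%d<d j d)) ⟩
    d + (j ℤ./ d) * d           ≡⟨ lemma (j ℤ./ d) d ⟩
    (j ℤ./ d + + 1) * d         ∎))
    where lemma : ∀ a d → d + a * d ≡ (a + + 1) * d
          lemma = solve-∀

ceiling≡-[-↥p/↧p] : ∀ p → ceiling p ≡ - ((- ↥ p) ℤ./ ↧ p)
ceiling≡-[-↥p/↧p] (mkℚ (+ zero) _ _)  = refl
ceiling≡-[-↥p/↧p] (mkℚ (+ suc _) _ _) = refl
ceiling≡-[-↥p/↧p] (mkℚ -[1+ _ ] _ _)  = refl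

⌈p⌉≤i⇔↥p≤i*↧p : ∀ p i → ceiling p ≤ i ⇔ ↥ p ≤ i * ↧ p
⌈p⌉≤i⇔↥p≤i*↧p p@(mkℚ u d _) i = begin
  ceiling p ≤ i              ≡⟨ cong₂ _≤_ (ceiling≡-[-↥p/↧p] p) (sym (ℤ.neg-involutive i)) ⟩
  - f ≤ - - i                ≈⟨ neg-≤⇔ ⟩
  - i ≤ f                    ≈⟨ i≤j/k⇔i*k≤j (- i) (- u) d ⟩
  - i * + suc d ≤ - u        ≡⟨ cong (_≤ - u) (sym (ℤ.neg-distribˡ-* i (+ suc d))) ⟩
  - (i * + suc d) ≤ - u      ≈⟨ neg-≤⇔ ⟩
  u ≤ i * + suc d            ∎
  where
  open ⇔-Reasoning
  f : ℤ
  f = (- u) ℤ./ + suc d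

ceilDiv-galois : ∀ a N .{{_ : NonZero N}} x → ceilDiv a N ≤ x ⇔ a ≤ + N * x
ceilDiv-galois a N x = begin
  ceiling p ≤ x             ≈⟨ ⌈p⌉≤i⇔↥p≤i*↧p p x ⟩
  ↥ p ≤ x * ↧ p             ≈⟨ *-cancelʳ-≤⇔ g {{g≢0}} ⟨
  ↥ p * + g ≤ x * ↧ p * + g ≡⟨ cong₂ _≤_ (ℚ.↥-/ a N) denominator ⟩
  a ≤ + N * x               ∎
  where
  open ⇔-Reasoning
  p : ℚ
  p = a ℚ./ N
  g = ℕ.gcd ∣ a ∣ N
  g≢0 : NonZero g
  g≢0 = ℕ.≢-nonZero (ℕ.gcd[m,n]≢0 ∣ a ∣ N (inj₂ (ℕ.≢-nonZero⁻¹ N)))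
  denominator : x * ↧ p * + g ≡ + N * x
  denominator = trans (lemma x (↧ p) (+ g)) (cong (_* x) (ℚ.↧-/ a N))
    where lemma : ∀ x v g → x * v * g ≡ v * g * x
          lemma = solve-∀

ceilDiv-unique : ∀ a N .{{_ : NonZero N}} c → (∀ x → c ≤ x ⇔ a ≤ + N * x) → ceilDiv a N ≡ c
ceilDiv-unique a N c galois = ℤ.≤-antisym
  (Equivalence.from (ceilDiv-galois a N c) (Equivalence.to (galois c) ℤ.≤-refl))
  (Equivalence.from (galois _) (Equivalence.to (ceilDiv-galois a N _) ℤ.≤-refl))

⌈0/N⌉≡0 : ∀ N .{{_ : NonZero N}} → ceilDiv (+ 0) N ≡ + 0
⌈0/N⌉≡0 N = ceilDiv-unique (+ 0) N (+ 0) λ x →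
  ⇔.sym (⇔.trans (≡⇒⇔ (cong (_≤ + N * x) (sym (ℤ.*-zeroʳ (+ N))))) (*-cancelˡ-≤⇔ N))

⌈[a+N*k]/N⌉≡⌈a/N⌉+k : ∀ a N .{{_ : NonZero N}} k → ceilDiv (a + + N * k) N ≡ ceilDiv a N + k
⌈[a+N*k]/N⌉≡⌈a/N⌉+k a N k = ceilDiv-unique _ N _ λ x → begin
  ceilDiv a N + k ≤ x                   ≡⟨ cong (ceilDiv a N + k ≤_) (lemma₁ x k) ⟩
  ceilDiv a N + k ≤ x - k + k           ≈⟨ +-cancelʳ-≤⇔ k ⟩
  ceilDiv a N ≤ x - k                   ≈⟨ ceilDiv-galois a N (x - k) ⟩
  a ≤ + N * (x - k)                     ≈⟨ +-cancelʳ-≤⇔ (+ N * k) ⟨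
  a + + N * k ≤ + N * (x - k) + + N * k ≡⟨ cong (a + + N * k ≤_) (lemma₂ (+ N) x k) ⟩
  a + + N * k ≤ + N * x                 ∎
  where
  open ⇔-Reasoning
  lemma₁ : ∀ x k → x ≡ x - k + k
  lemma₁ = solve-∀
  lemma₂ : ∀ n x k → n * (x - k) + n * k ≡ n * x
  lemma₂ = solve-∀

⌈a*m/[m*N]⌉≡⌈a/N⌉ : ∀ a m N .{{_ : NonZero N}} .{{_ : NonZero (suc m ℕ.* N)}} →
  ceilDiv (a * + suc m) (suc m ℕ.* N) ≡ ceilDiv a N
⌈a*m/[m*N]⌉≡⌈a/N⌉ a m N = ceilDiv-unique _ _ _ λ x → begin
  ceilDiv a N ≤ x                     ≈⟨ ceilDiv-galois a N x ⟩
  a ≤ + N * x                         ≈⟨ *-cancelʳ-≤⇔ (suc m) ⟨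
  a * + suc m ≤ + N * x * + suc m     ≡⟨ cong (a * + suc m ≤_) (lemma x) ⟩
  a * + suc m ≤ + (suc m ℕ.* N) * x   ∎
  where
  open ⇔-Reasoning
  lemma : ∀ x → + N * x * + suc m ≡ + (suc m ℕ.* N) * x
  lemma x = trans (ring (+ N) x (+ suc m)) (cong (_* x) (sym (ℤ.pos-* (suc m) N)))
    where ring : ∀ n x m → n * x * m ≡ m * n * x
          ring = solve-∀

-- Write n = k·∣q∣. For q > 0 both sides are ≤ x exactly when j < k·x, for q < 0 exactly when −j ≤ k·x.
⌈q[jm+b]/mn⌉≡⌈[qj+q⁺]/n⌉ : ∀ q m n .{{_ : NonZero n}} .{{_ : NonZero (m ℕ.* n)}} → q ∣ + n →
  ∀ j b → 0 ℕ.< b → b ℕ.< m →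
  ceilDiv (q * + (j ℕ.* m ℕ.+ b)) (m ℕ.* n) ≡ ceilDiv (q * + j + q ⁺) n
⌈q[jm+b]/mn⌉≡⌈[qj+q⁺]/n⌉ (+ zero) m n (ℕ.divides k n≡k*0) j b _ _ =
  contradiction (trans n≡k*0 (ℕ.*-zeroʳ k)) (ℕ.≢-nonZero⁻¹ n)
⌈q[jm+b]/mn⌉≡⌈[qj+q⁺]/n⌉ q@(+ suc Q) m n (ℕ.divides k n≡k*q) j b 0<b b<m = ceilDiv-unique _ _ _ λ x → begin
  ceilDiv (q * + j + q) n ≤ x                   ≈⟨ ceilDiv-galois _ n x ⟩
  q * + j + q ≤ + n * x                         ≡⟨ cong₂ _≤_ (lemma q (+ j)) (+n*x≡Q*[k*x] {k = k} {Q = suc Q} n≡k*q x) ⟩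
  q * (+ 1 + + j) ≤ q * (+ k * x)               ≈⟨ *-cancelˡ-≤⇔ (suc Q) ⟩
  + 1 + + j ≤ + k * x                           ≈⟨ 1+i≤j⇔i<j ⟩
  + j < + k * x                                 ≈⟨ j*m+b≤m*y⇔j<y 0<b b<m (+ j) (+ k * x) ⟨
  + j * + m + + b ≤ + m * (+ k * x)             ≈⟨ *-cancelˡ-≤⇔ (suc Q) ⟨
  q * (+ j * + m + + b) ≤ q * (+ m * (+ k * x)) ≡⟨ cong₂ _≤_ (cong (q *_) (sym (pos-*-+ j m b)))
                                                           (sym (+[m*n]*x≡Q*[m*[k*x]] {k = k} {Q = suc Q} n≡k*q m x)) ⟩
  q * + (j ℕ.* m ℕ.+ b) ≤ + (m ℕ.* n) * x       ∎
  where
  open ⇔-Reasoning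
  lemma : ∀ q j → q * j + q ≡ q * (+ 1 + j)
  lemma = solve-∀
⌈q[jm+b]/mn⌉≡⌈[qj+q⁺]/n⌉ q@(-[1+ Q ]) m n (ℕ.divides k n≡k*∣q∣) j b 0<b b<m = ceilDiv-unique _ _ _ λ x → begin
  ceilDiv (q * + j + + 0) n ≤ x                           ≈⟨ ceilDiv-galois _ n x ⟩
  q * + j + + 0 ≤ + n * x                                 ≡⟨ cong₂ _≤_ (lemma₁ (+ suc Q) (+ j))
                                                                     (+n*x≡Q*[k*x] {k = k} {Q = suc Q} n≡k*∣q∣ x) ⟩
  + suc Q * - + j ≤ + suc Q * (+ k * x)                   ≈⟨ *-cancelˡ-≤⇔ (suc Q) ⟩
  - + j ≤ + k * x                                         ≈⟨ -[j*m+b]≤m*y⇔-j≤y 0<b b<m (+ j) (+ k * x) ⟨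
  - (+ j * + m + + b) ≤ + m * (+ k * x)                   ≈⟨ *-cancelˡ-≤⇔ (suc Q) ⟨
  + suc Q * - (+ j * + m + + b) ≤ + suc Q * (+ m * (+ k * x))
                                                          ≡⟨ cong₂ _≤_ (trans (lemma₂ (+ suc Q) _) (cong (q *_) (sym (pos-*-+ j m b))))
                                                                     (sym (+[m*n]*x≡Q*[m*[k*x]] {k = k} {Q = suc Q} n≡k*∣q∣ m x)) ⟩
  q * + (j ℕ.* m ℕ.+ b) ≤ + (m ℕ.* n) * x                 ∎
  where
  open ⇔-Reasoning
  lemma₁ : ∀ Q j → - Q * j + + 0 ≡ Q * - j
  lemma₁ = solve-∀
  lemma₂ : ∀ Q a → Q * - a ≡ - Q * a
  lemma₂ = solve-∀

-- The weight function

weight : ∀ {D} → Vec ℤ D → (N : ℕ) .{{_ : NonZero N}} → ℕ → ℤ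
weight p N s = sumVecℤ (Vec.map (λ qi → ceilDiv (qi * + s) N) (qFull p))

module _ {D} (p : Vec ℤ D) (N : ℕ) .{{_ : NonZero N}} where

  weight-0 : weight p N 0 ≡ + 0
  weight-0 = sumVecℤ-map-≗0 (λ qi → trans (cong (λ a → ceilDiv a N) (ℤ.*-zeroʳ qi)) (⌈0/N⌉≡0 N)) (qFull p)

  weight-+N : ∀ s → weight p N (s ℕ.+ N) ≡ weight p N s + + 1
  weight-+N s = begin
    weight p N (s ℕ.+ N)                                           ≡⟨ cong sumVecℤ (Vec.map-cong shift (qFull p)) ⟩
    sumVecℤ (Vec.map (λ qi → ceilDiv (qi * + s) N + qi) (qFull p))  ≡⟨ sumVecℤ-map-+ _ (λ qi → qi) (qFull p) ⟩
    weight p N s + sumVecℤ (Vec.map (λ qi → qi) (qFull p))          ≡⟨ cong (λ v → weight p N s + sumVecℤ v) (Vec.map-id (qFull p)) ⟩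
    weight p N s + sumVecℤ (qFull p)                               ≡⟨ cong (_+_ (weight p N s)) (sumVecℤ-qFull p) ⟩
    weight p N s + + 1                                             ∎
    where
    open ≡-Reasoning
    shift : ∀ qi → ceilDiv (qi * + (s ℕ.+ N)) N ≡ ceilDiv (qi * + s) N + qi
    shift qi = trans (cong (λ a → ceilDiv a N) (trans (cong (qi *_) (ℤ.pos-+ s N)) (lemma qi (+ s) (+ N))))
                     (⌈[a+N*k]/N⌉≡⌈a/N⌉+k (qi * + s) N qi)
      where lemma : ∀ q s n → q * (s + n) ≡ q * s + n * q
            lemma = solve-∀

  s≤N*weight : ∀ s → + s ≤ + N * weight p N s
  s≤N*weight s = begin
    + s                                                      ≡⟨ sym (trans (cong (+ s *_) (sumVecℤ-qFull p)) (ℤ.*-identityʳ (+ s))) ⟩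
    + s * sumVecℤ (qFull p)                                  ≡⟨ cong (λ v → + s * sumVecℤ v) (Vec.map-id (qFull p)) ⟨
    + s * sumVecℤ (Vec.map (λ qi → qi) (qFull p))            ≡⟨ sumVecℤ-map-*ˡ (+ s) (λ qi → qi) (qFull p) ⟨
    sumVecℤ (Vec.map (λ qi → + s * qi) (qFull p))            ≤⟨ sumVecℤ-map-mono-≤ below-ceiling (qFull p) ⟩
    sumVecℤ (Vec.map (λ qi → + N * ceilDiv (qi * + s) N) (qFull p)) ≡⟨ sumVecℤ-map-*ˡ (+ N) _ (qFull p) ⟩
    + N * weight p N s                                       ∎
    where
    open ℤ.≤-Reasoning
    below-ceiling : ∀ qi → + s * qi ≤ + N * ceilDiv (qi * + s) N
    below-ceiling qi = subst (_≤ + N * ceilDiv (qi * + s) N) (ℤ.*-comm qi (+ s))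
      (Equivalence.to (ceilDiv-galois (qi * + s) N _) ℤ.≤-refl)

  weight-nonneg : ∀ s → + 0 ≤ weight p N s
  weight-nonneg s = Equivalence.to (*-cancelˡ-≤⇔ N)
    (ℤ.≤-trans (ℤ.≤-reflexive (ℤ.*-zeroʳ (+ N))) (ℤ.≤-trans (ℤ.+≤+ ℕ.z≤n) (s≤N*weight s)))

  kN<s⇒k<weight : ∀ k s → k ℕ.* N ℕ.< s → + k < weight p N s
  kN<s⇒k<weight k s kN<s = ℤ.*-cancelˡ-<-nonNeg (+ N) (ℤ.<-≤-trans
    (subst (_< + s) (trans (ℤ.pos-* k N) (ℤ.*-comm (+ k) (+ N))) (ℤ.+<+ kN<s)) (s≤N*weight s))

module _ {D} (q : Vec ℤ D) (m n : ℕ) .{{_ : NonZero n}} where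
  private instance
    m*n≢0 : NonZero (suc m ℕ.* n)
    m*n≢0 = ℕ.m*n≢0 (suc m) n

  weight-multiple : ∀ j → weight q (suc m ℕ.* n) (j ℕ.* suc m) ≡ weight q n j
  weight-multiple j = cong sumVecℤ (Vec.map-cong scale (qFull q))
    where
    scale : ∀ qi → ceilDiv (qi * + (j ℕ.* suc m)) (suc m ℕ.* n) ≡ ceilDiv (qi * + j) n
    scale qi = trans (cong (λ a → ceilDiv a (suc m ℕ.* n)) (trans (cong (qi *_) (ℤ.pos-* j (suc m))) (sym (ℤ.*-assoc qi (+ j) _))))
                     (⌈a*m/[m*N]⌉≡⌈a/N⌉ (qi * + j) m n)

  weight-interior : (∀ i → lookup (qFull q) i ∣ + n) → ∀ j b → 0 ℕ.< b → b ℕ.< suc m →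
    weight q (suc m ℕ.* n) (j ℕ.* suc m ℕ.+ b) ≡ expo q n j
  weight-interior q∣n j b 0<b b<m = cong sumVecℤ (map-cong-lookup (qFull q)
    (λ i → ⌈q[jm+b]/mn⌉≡⌈[qj+q⁺]/n⌉ (lookup (qFull q) i) (suc m) n (q∣n i) j b 0<b b<m))

-- e(j) is the weight of q⁽²⁾ at the odd height 2j + 1, hence positive.
expo-positive : ∀ {D} (q : Vec ℤ D) n .{{_ : NonZero n}} → (∀ i → lookup (qFull q) i ∣ + n) →
  ∀ j → + 0 < expo q n j
expo-positive q n q∣n j = subst (+ 0 <_) (weight-interior q 1 n q∣n j 1 ℕ.≤-refl ℕ.≤-refl)
  (kN<s⇒k<weight q (2 ℕ.* n) {{ℕ.m*n≢0 2 n}} 0 (j ℕ.* 2 ℕ.+ 1) (ℕ.m≤n+m 1 (j ℕ.* 2)))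

-- Barycentric coordinates in Δ(0,p)

ℚ-ring : ACR.AlmostCommutativeRing 0ℓ 0ℓ
ℚ-ring = ACR.fromCommutativeRing ℚ.+-*-commutativeRing (λ x → dec⇒maybe (ℚ.0ℚ ℚ.≟ x))

-- toℚ a = a / 1 only reduces after a gcd computation; rewriting it to its normal form fromℤ a lets ℚ arithmetic compute.
fromℤ : ℤ → ℚ
fromℤ a = mkℚ a 0 (ℕ.sym (ℕ.1-coprimeTo ∣ a ∣))

toℚ≡fromℤ : ∀ a → toℚ a ≡ fromℤ a
toℚ≡fromℤ a = ℚ.↥p/↧p≡p (fromℤ a)

toℚ-+ : ∀ a b → toℚ (a + b) ≡ toℚ a ℚ.+ toℚ b
toℚ-+ a b rewrite toℚ≡fromℤ a | toℚ≡fromℤ b =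
  cong (ℚ._/ 1) (cong₂ _+_ (sym (ℤ.*-identityʳ a)) (sym (ℤ.*-identityʳ b)))

toℚ-* : ∀ a b → toℚ (a * b) ≡ toℚ a ℚ.* toℚ b
toℚ-* a b rewrite toℚ≡fromℤ a | toℚ≡fromℤ b = refl

toℚ-neg : ∀ a → toℚ (- a) ≡ ℚ.- toℚ a
toℚ-neg a rewrite toℚ≡fromℤ a | toℚ≡fromℤ (- a) = fromℤ-neg a
  where
  fromℤ-neg : ∀ a → fromℤ (- a) ≡ ℚ.- fromℤ a
  fromℤ-neg (+ zero)  = refl
  fromℤ-neg (+ suc _) = refl
  fromℤ-neg -[1+ _ ]  = refl

toℚ-sub : ∀ a b → toℚ (a - b) ≡ toℚ a ℚ.- toℚ b
toℚ-sub a b = trans (toℚ-+ a (- b)) (cong (toℚ a ℚ.+_) (toℚ-neg b))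

0≤toℚ⇔0≤ : ∀ a → ℚ.0ℚ ℚ.≤ toℚ a ⇔ + 0 ≤ a
0≤toℚ⇔0≤ a rewrite toℚ≡fromℤ a = mk⇔
  (λ { (ℚ.*≤* 0≤a*1) → subst (+ 0 ≤_) (ℤ.*-identityʳ a) 0≤a*1 })
  (λ 0≤a → ℚ.*≤* (subst (+ 0 ≤_) (sym (ℤ.*-identityʳ a)) 0≤a))

sumFinℚ-cong : ∀ {k} {f g : Fin k → ℚ} → (∀ i → f i ≡ g i) → sumFinℚ f ≡ sumFinℚ g
sumFinℚ-cong {zero}  e = refl
sumFinℚ-cong {suc k} e = cong₂ ℚ._+_ (e zero) (sumFinℚ-cong (λ i → e (suc i)))

sumFinℚ-+ : ∀ {k} (f g : Fin k → ℚ) → sumFinℚ (λ i → f i ℚ.+ g i) ≡ sumFinℚ f ℚ.+ sumFinℚ g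
sumFinℚ-+ {zero}  f g = refl
sumFinℚ-+ {suc k} f g = trans (cong (f zero ℚ.+ g zero ℚ.+_) (sumFinℚ-+ (λ i → f (suc i)) (λ i → g (suc i))))
                              (lemma (f zero) (g zero) _ _)
  where lemma : ∀ a b c d → a ℚ.+ b ℚ.+ (c ℚ.+ d) ≡ a ℚ.+ c ℚ.+ (b ℚ.+ d)
        lemma = solve-∀-in ℚ-ring

sumFinℚ-*ˡ : ∀ {k} c (f : Fin k → ℚ) → sumFinℚ (λ i → c ℚ.* f i) ≡ c ℚ.* sumFinℚ f
sumFinℚ-*ˡ {zero}  c f = sym (ℚ.*-zeroʳ c)
sumFinℚ-*ˡ {suc k} c f = trans (cong (c ℚ.* f zero ℚ.+_) (sumFinℚ-*ˡ c (λ i → f (suc i))))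
                               (sym (ℚ.*-distribˡ-+ c (f zero) _))

sumFinℚ-*0 : ∀ {k} (f : Fin k → ℚ) → sumFinℚ (λ i → f i ℚ.* toℚ (+ 0)) ≡ ℚ.0ℚ
sumFinℚ-*0 {k} f = trans (sumFinℚ-cong (λ i → ℚ.*-zeroʳ (f i))) (zeros k)
  where zeros : ∀ k → sumFinℚ {k} (λ _ → ℚ.0ℚ) ≡ ℚ.0ℚ
        zeros zero    = refl
        zeros (suc k) = cong (ℚ.0ℚ ℚ.+_) (zeros k)

sumFinℚ-toℚ : ∀ {k} (v : Vec ℤ k) → sumFinℚ (λ i → toℚ (lookup v i)) ≡ toℚ (sumVecℤ v)
sumFinℚ-toℚ []      = refl
sumFinℚ-toℚ (x ∷ v) = trans (cong (toℚ x ℚ.+_) (sumFinℚ-toℚ v)) (sym (toℚ-+ x (sumVecℤ v)))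

sumFinℚ-δ : ∀ {k} (f : Fin k → ℚ) (j : Fin k) →
  sumFinℚ (λ i → f i ℚ.* toℚ (if does (toℕ j ℕ.≟ toℕ i) then + 1 else + 0)) ≡ f j
sumFinℚ-δ f zero    = trans (cong (f zero ℚ.* ℚ.1ℚ ℚ.+_) (sumFinℚ-*0 (λ i → f (suc i)))) (lemma (f zero))
  where lemma : ∀ a → a ℚ.* ℚ.1ℚ ℚ.+ ℚ.0ℚ ≡ a
        lemma = solve-∀-in ℚ-ring
sumFinℚ-δ f (suc j) = trans (cong (f zero ℚ.* ℚ.0ℚ ℚ.+_) (sumFinℚ-δ (λ i → f (suc i)) j)) (lemma (f zero) (f (suc j)))
  where lemma : ∀ a b → a ℚ.* ℚ.0ℚ ℚ.+ b ≡ b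
        lemma = solve-∀-in ℚ-ring

sumFinℚ-δ-outside : ∀ {k} (f : Fin k → ℚ) →
  sumFinℚ (λ i → f i ℚ.* toℚ (if does (k ℕ.≟ toℕ i) then + 1 else + 0)) ≡ ℚ.0ℚ
sumFinℚ-δ-outside {zero}  f = refl
sumFinℚ-δ-outside {suc k} f = trans (cong (f zero ℚ.* ℚ.0ℚ ℚ.+_) (sumFinℚ-δ-outside (λ i → f (suc i)))) (lemma (f zero))
  where lemma : ∀ a → a ℚ.* ℚ.0ℚ ℚ.+ ℚ.0ℚ ≡ ℚ.0ℚ
        lemma = solve-∀-in ℚ-ring

module _ {D} (p : Vec ℤ D) (h : ℤ) (lam : Fin (suc (suc D)) → ℚ) where

  combination : Fin (suc D) → ℚ
  combination j = sumFinℚ (λ i → lam i ℚ.* toℚ (lookup (vertΔ p h i) j))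

  private
    μ : Fin D → ℚ
    μ i = lam (suc (suc i))

    combination≡ : ∀ j → combination j ≡
      lam (suc zero) ℚ.* toℚ (lookup (p ∷ʳ h) j)
        ℚ.+ sumFinℚ (λ i → μ i ℚ.* toℚ (if does (toℕ j ℕ.≟ toℕ i) then + 1 else + 0))
    combination≡ j = trans
      (cong₂ (λ o e → lam zero ℚ.* toℚ o ℚ.+ (lam (suc zero) ℚ.* toℚ (lookup (p ∷ʳ h) j) ℚ.+ e))
             (Vec.lookup-replicate j (+ 0))
             (sumFinℚ-cong (λ i → cong (λ e → μ i ℚ.* toℚ e)
               (Vec.lookup∘tabulate (λ k → if does (toℕ k ℕ.≟ toℕ i) then + 1 else + 0) j))))
      (lemma (lam zero) (lam (suc zero) ℚ.* toℚ (lookup (p ∷ʳ h) j)) _)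
      where lemma : ∀ a b c → a ℚ.* ℚ.0ℚ ℚ.+ (b ℚ.+ c) ≡ b ℚ.+ c
            lemma = solve-∀-in ℚ-ring

  combination-inject₁ : ∀ i → combination (inject₁ i) ≡ lam (suc zero) ℚ.* toℚ (lookup p i) ℚ.+ μ i
  combination-inject₁ i = trans (combination≡ (inject₁ i)) (cong₂ (λ a b → lam (suc zero) ℚ.* toℚ a ℚ.+ b)
    (lookup-∷ʳ-inject₁ p h i)
    (trans (sumFinℚ-cong (λ k → cong (λ j → μ k ℚ.* toℚ (if does (j ℕ.≟ toℕ k) then + 1 else + 0)) (Fin.toℕ-inject₁ i)))
           (sumFinℚ-δ μ i)))

  combination-fromℕ : combination (fromℕ D) ≡ lam (suc zero) ℚ.* toℚ h
  combination-fromℕ = trans (combination≡ (fromℕ D)) (trans (cong₂ (λ a b → lam (suc zero) ℚ.* toℚ a ℚ.+ b)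
    (lookup-∷ʳ-fromℕ p h)
    (trans (sumFinℚ-cong (λ k → cong (λ j → μ k ℚ.* toℚ (if does (j ℕ.≟ toℕ k) then + 1 else + 0)) (Fin.toℕ-fromℕ D)))
           (sumFinℚ-δ-outside μ)))
    (ℚ.+-identityʳ _))

sumFinℚ-*-* : ∀ {k} c d (f g : Fin k → ℚ) →
  sumFinℚ (λ i → c ℚ.* f i ℚ.- g i ℚ.* d) ≡ c ℚ.* sumFinℚ f ℚ.- sumFinℚ g ℚ.* d
sumFinℚ-*-* {zero}  c d f g = lemma c d
  where lemma : ∀ c d → ℚ.0ℚ ≡ c ℚ.* ℚ.0ℚ ℚ.- ℚ.0ℚ ℚ.* d
        lemma = solve-∀-in ℚ-ring
sumFinℚ-*-* {suc k} c d f g =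
  trans (cong (c ℚ.* f zero ℚ.- g zero ℚ.* d ℚ.+_) (sumFinℚ-*-* c d (λ i → f (suc i)) (λ i → g (suc i))))
        (lemma c d (f zero) (g zero) _ _)
  where lemma : ∀ c d a b F G → c ℚ.* a ℚ.- b ℚ.* d ℚ.+ (c ℚ.* F ℚ.- G ℚ.* d) ≡ c ℚ.* (a ℚ.+ F) ℚ.- (b ℚ.+ G) ℚ.* d
        lemma = solve-∀-in ℚ-ring

toℚ-*-* : ∀ a b c d → toℚ (a * b - c * d) ≡ toℚ a ℚ.* toℚ b ℚ.- toℚ c ℚ.* toℚ d
toℚ-*-* a b c d = trans (toℚ-sub (a * b) (c * d)) (cong₂ ℚ._-_ (toℚ-* a b) (toℚ-* c d))

i≤j⇔0≤toℚ[j-i] : ∀ {i j} → i ≤ j ⇔ ℚ.0ℚ ℚ.≤ toℚ (j - i)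
i≤j⇔0≤toℚ[j-i] {i} {j} = ⇔.trans (mk⇔ ℤ.i≤j⇒0≤j-i ℤ.0≤i-j⇒j≤i) (⇔.sym (0≤toℚ⇔0≤ (j - i)))

0≤x⇒0≤y⇒0≤x*y : ∀ {x y} → ℚ.0ℚ ℚ.≤ x → ℚ.0ℚ ℚ.≤ y → ℚ.0ℚ ℚ.≤ x ℚ.* y
0≤x⇒0≤y⇒0≤x*y {x} {y} 0≤x 0≤y = ℚ.nonNegative⁻¹ (x ℚ.* y)
  {{ℚ.nonNeg*nonNeg⇒nonNeg x {{ℚ.nonNegative 0≤x}} y {{ℚ.nonNegative 0≤y}}}}

-- The barycentric coordinates of (xs ∷ʳ s) in t·Δ(0,p) with apex height N are s/N, (N xᵢ − pᵢ s)/N and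
-- (N (t − Σ xs) − q_d s)/N, where q_d = 1 − Σ p.
InDilateℤ : ∀ {D} → Vec ℤ D → ℕ → ℕ → Vec ℤ D → ℤ → Set
InDilateℤ p N t xs s =
  (+ 0 ≤ s) × (∀ i → lookup p i * s ≤ + N * lookup xs i) × ((+ 1 - sumVecℤ p) * s ≤ + N * (+ t - sumVecℤ xs))

module _ {D} (p : Vec ℤ D) (n t : ℕ) (xs : Vec ℤ D) (s : ℤ) where
  private
    N : ℕ
    N = suc n
    Nℚ T P X S : ℚ
    Nℚ = toℚ (+ N)
    T = toℚ (+ t)
    P = toℚ (sumVecℤ p)
    X = toℚ (sumVecℤ xs)
    S = toℚ s
    ν₀ : ℤ
    ν₀ = + N * (+ t - sumVecℤ xs) - (+ 1 - sumVecℤ p) * s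
    ν : Fin D → ℤ
    ν i = + N * lookup xs i - lookup p i * s
    0≤Nℚ : ℚ.0ℚ ℚ.≤ Nℚ
    0≤Nℚ = Equivalence.from (0≤toℚ⇔0≤ (+ N)) (ℤ.+≤+ ℕ.z≤n)
    open ≡-Reasoning

  toℚ-ν₀ : toℚ ν₀ ≡ Nℚ ℚ.* (T ℚ.- X) ℚ.- (ℚ.1ℚ ℚ.- P) ℚ.* S
  toℚ-ν₀ = trans (toℚ-*-* (+ N) (+ t - sumVecℤ xs) (+ 1 - sumVecℤ p) s)
    (cong₂ (λ a b → Nℚ ℚ.* a ℚ.- b ℚ.* S) (toℚ-sub (+ t) (sumVecℤ xs)) (toℚ-sub (+ 1) (sumVecℤ p)))

  module _ (lam : Fin (suc (suc D)) → ℚ) (coord : ∀ j → toℚ (lookup (xs ∷ʳ s) j) ≡ combination p (+ N) lam j) where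
    private
      λ₁ : ℚ
      λ₁ = lam (suc zero)
      μ : Fin D → ℚ
      μ i = lam (suc (suc i))

    S≡λ₁*N : S ≡ λ₁ ℚ.* Nℚ
    S≡λ₁*N = trans (cong toℚ (sym (lookup-∷ʳ-fromℕ xs s))) (trans (coord (fromℕ D)) (combination-fromℕ p (+ N) lam))

    x≡λ₁*p+μ : ∀ i → toℚ (lookup xs i) ≡ λ₁ ℚ.* toℚ (lookup p i) ℚ.+ μ i
    x≡λ₁*p+μ i = trans (cong toℚ (sym (lookup-∷ʳ-inject₁ xs s i)))
                       (trans (coord (inject₁ i)) (combination-inject₁ p (+ N) lam i))

    toℚ-ν : ∀ i → toℚ (ν i) ≡ Nℚ ℚ.* μ i
    toℚ-ν i = begin
      toℚ (ν i)                                                  ≡⟨ toℚ-*-* (+ N) (lookup xs i) (lookup p i) s ⟩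
      Nℚ ℚ.* toℚ (lookup xs i) ℚ.- toℚ (lookup p i) ℚ.* S         ≡⟨ cong₂ (λ x s → Nℚ ℚ.* x ℚ.- toℚ (lookup p i) ℚ.* s)
                                                                            (x≡λ₁*p+μ i) S≡λ₁*N ⟩
      Nℚ ℚ.* (λ₁ ℚ.* toℚ (lookup p i) ℚ.+ μ i) ℚ.- toℚ (lookup p i) ℚ.* (λ₁ ℚ.* Nℚ)
                                                                 ≡⟨ lemma Nℚ λ₁ (toℚ (lookup p i)) (μ i) ⟩
      Nℚ ℚ.* μ i                                                 ∎
      where lemma : ∀ N l p m → N ℚ.* (l ℚ.* p ℚ.+ m) ℚ.- p ℚ.* (l ℚ.* N) ≡ N ℚ.* m
            lemma = solve-∀-in ℚ-ring

    X≡λ₁*P+Σμ : X ≡ λ₁ ℚ.* P ℚ.+ sumFinℚ μ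
    X≡λ₁*P+Σμ = begin
      X                                                       ≡⟨ sumFinℚ-toℚ xs ⟨
      sumFinℚ (λ i → toℚ (lookup xs i))                       ≡⟨ sumFinℚ-cong x≡λ₁*p+μ ⟩
      sumFinℚ (λ i → λ₁ ℚ.* toℚ (lookup p i) ℚ.+ μ i)         ≡⟨ sumFinℚ-+ (λ i → λ₁ ℚ.* toℚ (lookup p i)) μ ⟩
      sumFinℚ (λ i → λ₁ ℚ.* toℚ (lookup p i)) ℚ.+ sumFinℚ μ   ≡⟨ cong (ℚ._+ sumFinℚ μ) (sumFinℚ-*ˡ λ₁ (λ i → toℚ (lookup p i))) ⟩
      λ₁ ℚ.* sumFinℚ (λ i → toℚ (lookup p i)) ℚ.+ sumFinℚ μ   ≡⟨ cong (λ a → λ₁ ℚ.* a ℚ.+ sumFinℚ μ) (sumFinℚ-toℚ p) ⟩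
      λ₁ ℚ.* P ℚ.+ sumFinℚ μ                                  ∎

    toℚ-ν₀≡N*λ₀ : sumFinℚ lam ≡ T → toℚ ν₀ ≡ Nℚ ℚ.* lam zero
    toℚ-ν₀≡N*λ₀ Σlam≡t = begin
      toℚ ν₀                                                      ≡⟨ toℚ-ν₀ ⟩
      Nℚ ℚ.* (T ℚ.- X) ℚ.- (ℚ.1ℚ ℚ.- P) ℚ.* S                       ≡⟨ cong₂ (λ t x → Nℚ ℚ.* (t ℚ.- x) ℚ.- (ℚ.1ℚ ℚ.- P) ℚ.* S)
                                                                             (sym Σlam≡t) X≡λ₁*P+Σμ ⟩
      Nℚ ℚ.* (sumFinℚ lam ℚ.- (λ₁ ℚ.* P ℚ.+ sumFinℚ μ)) ℚ.- (ℚ.1ℚ ℚ.- P) ℚ.* S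
                                                                  ≡⟨ cong (λ s → Nℚ ℚ.* (sumFinℚ lam ℚ.- (λ₁ ℚ.* P ℚ.+ sumFinℚ μ))
                                                                                   ℚ.- (ℚ.1ℚ ℚ.- P) ℚ.* s) S≡λ₁*N ⟩
      Nℚ ℚ.* (lam zero ℚ.+ (λ₁ ℚ.+ sumFinℚ μ) ℚ.- (λ₁ ℚ.* P ℚ.+ sumFinℚ μ)) ℚ.- (ℚ.1ℚ ℚ.- P) ℚ.* (λ₁ ℚ.* Nℚ)
                                                                  ≡⟨ lemma Nℚ (lam zero) λ₁ (sumFinℚ μ) P ⟩
      Nℚ ℚ.* lam zero                                             ∎
      where lemma : ∀ N l₀ l₁ M P → N ℚ.* (l₀ ℚ.+ (l₁ ℚ.+ M) ℚ.- (l₁ ℚ.* P ℚ.+ M)) ℚ.- (ℚ.1ℚ ℚ.- P) ℚ.* (l₁ ℚ.* N) ≡ N ℚ.* l₀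
            lemma = solve-∀-in ℚ-ring

  inDilate⇒inDilateℤ : InDilate t (vertΔ p (+ N)) (xs ∷ʳ s) → InDilateℤ p N t xs s
  inDilate⇒inDilateℤ (lam , 0≤lam , Σlam≡t , coord) =
    Equivalence.to (0≤toℚ⇔0≤ s) (nonneg (S≡λ₁*N lam coord) (0≤x⇒0≤y⇒0≤x*y (0≤lam (suc zero)) 0≤Nℚ)) ,
    (λ i → Equivalence.from i≤j⇔0≤toℚ[j-i] (nonneg (toℚ-ν lam coord i) (0≤x⇒0≤y⇒0≤x*y 0≤Nℚ (0≤lam (suc (suc i)))))) ,
    Equivalence.from i≤j⇔0≤toℚ[j-i] (nonneg (toℚ-ν₀≡N*λ₀ lam coord Σlam≡t) (0≤x⇒0≤y⇒0≤x*y 0≤Nℚ (0≤lam zero)))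
    where
    nonneg : ∀ {a b} → a ≡ b → ℚ.0ℚ ℚ.≤ b → ℚ.0ℚ ℚ.≤ a
    nonneg a≡b = subst (ℚ.0ℚ ℚ.≤_) (sym a≡b)

  private
    invN : ℚ
    invN = ℚ.1/ fromℤ (+ N)

    invN*[N*a]≡a : ∀ a → invN ℚ.* (Nℚ ℚ.* a) ≡ a
    invN*[N*a]≡a a = begin
      invN ℚ.* (Nℚ ℚ.* a)        ≡⟨ lemma invN Nℚ a ⟩
      Nℚ ℚ.* invN ℚ.* a          ≡⟨ cong (λ n → n ℚ.* invN ℚ.* a) (toℚ≡fromℤ (+ N)) ⟩
      fromℤ (+ N) ℚ.* invN ℚ.* a ≡⟨ cong (ℚ._* a) (ℚ.*-inverseʳ (fromℤ (+ N))) ⟩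
      ℚ.1ℚ ℚ.* a                 ≡⟨ ℚ.*-identityˡ a ⟩
      a                          ∎
      where lemma : ∀ i n a → i ℚ.* (n ℚ.* a) ≡ n ℚ.* i ℚ.* a
            lemma = solve-∀-in ℚ-ring

  barycentric : Fin (suc (suc D)) → ℚ
  barycentric zero          = invN ℚ.* toℚ ν₀
  barycentric (suc zero)    = invN ℚ.* S
  barycentric (suc (suc i)) = invN ℚ.* toℚ (ν i)

  barycentric-nonneg : InDilateℤ p N t xs s → ∀ i → ℚ.0ℚ ℚ.≤ barycentric i
  barycentric-nonneg (0≤s , p*s≤N*x , qd*s≤N*[t-Σx]) = λ where
      zero          → 0≤x⇒0≤y⇒0≤x*y 0≤invN (Equivalence.to i≤j⇔0≤toℚ[j-i] qd*s≤N*[t-Σx])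
      (suc zero)    → 0≤x⇒0≤y⇒0≤x*y 0≤invN (Equivalence.from (0≤toℚ⇔0≤ s) 0≤s)
      (suc (suc i)) → 0≤x⇒0≤y⇒0≤x*y 0≤invN (Equivalence.to i≤j⇔0≤toℚ[j-i] (p*s≤N*x i))
    where
    0≤invN : ℚ.0ℚ ℚ.≤ invN
    0≤invN = ℚ.*≤* (ℤ.+≤+ ℕ.z≤n)

  sumFinℚ-barycentric : sumFinℚ barycentric ≡ T
  sumFinℚ-barycentric = begin
    invN ℚ.* toℚ ν₀ ℚ.+ (invN ℚ.* S ℚ.+ sumFinℚ (λ i → invN ℚ.* toℚ (ν i)))
      ≡⟨ cong (λ z → invN ℚ.* toℚ ν₀ ℚ.+ (invN ℚ.* S ℚ.+ z)) (trans (sumFinℚ-*ˡ invN (λ i → toℚ (ν i))) (cong (invN ℚ.*_) Σν)) ⟩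
    invN ℚ.* toℚ ν₀ ℚ.+ (invN ℚ.* S ℚ.+ invN ℚ.* (Nℚ ℚ.* X ℚ.- P ℚ.* S))
      ≡⟨ cong (λ z → invN ℚ.* z ℚ.+ (invN ℚ.* S ℚ.+ invN ℚ.* (Nℚ ℚ.* X ℚ.- P ℚ.* S))) toℚ-ν₀ ⟩
    invN ℚ.* (Nℚ ℚ.* (T ℚ.- X) ℚ.- (ℚ.1ℚ ℚ.- P) ℚ.* S) ℚ.+ (invN ℚ.* S ℚ.+ invN ℚ.* (Nℚ ℚ.* X ℚ.- P ℚ.* S))
      ≡⟨ lemma invN Nℚ T X P S ⟩
    invN ℚ.* (Nℚ ℚ.* T)
      ≡⟨ invN*[N*a]≡a T ⟩
    T ∎
    where
    Σν : sumFinℚ (λ i → toℚ (ν i)) ≡ Nℚ ℚ.* X ℚ.- P ℚ.* S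
    Σν = begin
      sumFinℚ (λ i → toℚ (ν i))                                            ≡⟨ sumFinℚ-cong (λ i → toℚ-*-* (+ N) (lookup xs i) (lookup p i) s) ⟩
      sumFinℚ (λ i → Nℚ ℚ.* toℚ (lookup xs i) ℚ.- toℚ (lookup p i) ℚ.* S)  ≡⟨ sumFinℚ-*-* Nℚ S (λ i → toℚ (lookup xs i)) (λ i → toℚ (lookup p i)) ⟩
      Nℚ ℚ.* sumFinℚ (λ i → toℚ (lookup xs i)) ℚ.- sumFinℚ (λ i → toℚ (lookup p i)) ℚ.* S
                                                                           ≡⟨ cong₂ (λ x p → Nℚ ℚ.* x ℚ.- p ℚ.* S) (sumFinℚ-toℚ xs) (sumFinℚ-toℚ p) ⟩
      Nℚ ℚ.* X ℚ.- P ℚ.* S                                                 ∎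
    lemma : ∀ i N T X P S → i ℚ.* (N ℚ.* (T ℚ.- X) ℚ.- (ℚ.1ℚ ℚ.- P) ℚ.* S) ℚ.+ (i ℚ.* S ℚ.+ i ℚ.* (N ℚ.* X ℚ.- P ℚ.* S))
                            ≡ i ℚ.* (N ℚ.* T)
    lemma = solve-∀-in ℚ-ring

  combination-barycentric : ∀ j → toℚ (lookup (xs ∷ʳ s) j) ≡ combination p (+ N) barycentric j
  combination-barycentric j with initOrLast j
  ... | init i = begin
    toℚ (lookup (xs ∷ʳ s) (inject₁ i))                  ≡⟨ cong toℚ (lookup-∷ʳ-inject₁ xs s i) ⟩
    toℚ (lookup xs i)                                   ≡⟨ invN*[N*a]≡a (toℚ (lookup xs i)) ⟨
    invN ℚ.* (Nℚ ℚ.* toℚ (lookup xs i))                 ≡⟨ lemma invN Nℚ S (toℚ (lookup xs i)) (toℚ (lookup p i)) ⟩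
    invN ℚ.* S ℚ.* toℚ (lookup p i) ℚ.+ invN ℚ.* (Nℚ ℚ.* toℚ (lookup xs i) ℚ.- toℚ (lookup p i) ℚ.* S)
                                                        ≡⟨ cong (λ z → invN ℚ.* S ℚ.* toℚ (lookup p i) ℚ.+ invN ℚ.* z)
                                                                (toℚ-*-* (+ N) (lookup xs i) (lookup p i) s) ⟨
    invN ℚ.* S ℚ.* toℚ (lookup p i) ℚ.+ invN ℚ.* toℚ (ν i) ≡⟨ combination-inject₁ p (+ N) barycentric i ⟨
    combination p (+ N) barycentric (inject₁ i)         ∎
    where lemma : ∀ i N S x p → i ℚ.* (N ℚ.* x) ≡ i ℚ.* S ℚ.* p ℚ.+ i ℚ.* (N ℚ.* x ℚ.- p ℚ.* S)
          lemma = solve-∀-in ℚ-ring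
  ... | last = begin
    toℚ (lookup (xs ∷ʳ s) (fromℕ D))          ≡⟨ cong toℚ (lookup-∷ʳ-fromℕ xs s) ⟩
    S                                         ≡⟨ invN*[N*a]≡a S ⟨
    invN ℚ.* (Nℚ ℚ.* S)                       ≡⟨ lemma invN Nℚ S ⟩
    invN ℚ.* S ℚ.* Nℚ                         ≡⟨ combination-fromℕ p (+ N) barycentric ⟨
    combination p (+ N) barycentric (fromℕ D) ∎
    where lemma : ∀ i N S → i ℚ.* (N ℚ.* S) ≡ i ℚ.* S ℚ.* N
          lemma = solve-∀-in ℚ-ring

inDilate⇔inDilateℤ : ∀ {D} (p : Vec ℤ D) N .{{_ : NonZero N}} t xs s →
  InDilate t (vertΔ p (+ N)) (xs ∷ʳ s) ⇔ InDilateℤ p N t xs s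
inDilate⇔inDilateℤ p zero    t xs s = contradiction refl (ℕ.≢-nonZero⁻¹ zero)
inDilate⇔inDilateℤ p (suc n) t xs s = mk⇔ (inDilate⇒inDilateℤ p n t xs s) λ inΔ →
  barycentric p n t xs s , barycentric-nonneg p n t xs s inΔ , sumFinℚ-barycentric p n t xs s , combination-barycentric p n t xs s

-- Counting lattice points

module _ {A : Set} where

  blocks : ℕ → (ℕ → List A) → List A
  blocks zero    B = []
  blocks (suc c) B = blocks c B ++ B c

  ∈-blocks⁻ : ∀ c B {x} → x ∈ blocks c B → Σ ℕ λ i → i ℕ.< c × x ∈ B i
  ∈-blocks⁻ (suc c) B x∈ with ∈-++⁻ (blocks c B) x∈
  ... | inj₁ x∈blocks = let i , i<c , x∈Bi = ∈-blocks⁻ c B x∈blocks in i , ℕ.m<n⇒m<1+n i<c , x∈Bi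
  ... | inj₂ x∈Bc     = c , ℕ.≤-refl , x∈Bc

  ∈-blocks⁺ : ∀ c B {x} i → i ℕ.< c → x ∈ B i → x ∈ blocks c B
  ∈-blocks⁺ (suc c) B i i<1+c x∈Bi with ℕ.m≤n⇒m<n∨m≡n (ℕ.s≤s⁻¹ i<1+c)
  ... | inj₁ i<c  = ∈-++⁺ˡ (∈-blocks⁺ c B i i<c x∈Bi)
  ... | inj₂ refl = ∈-++⁺ʳ (blocks c B) x∈Bi

  blocks-unique : ∀ c B (tag : A → ℕ) → (∀ i {x} → i ℕ.< c → x ∈ B i → tag x ≡ i) → (∀ i → Unique (B i)) →
    Unique (blocks c B)
  blocks-unique zero    B tag tagged unique = []
  blocks-unique (suc c) B tag tagged unique =
    ++⁺ (blocks-unique c B tag (λ i i<c → tagged i (ℕ.m<n⇒m<1+n i<c)) unique) (unique c) disjoint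
    where
    disjoint : ∀ {x} → ¬ (x ∈ blocks c B × x ∈ B c)
    disjoint (x∈blocks , x∈Bc) with ∈-blocks⁻ c B x∈blocks
    ... | i , i<c , x∈Bi = ℕ.<-irrefl (trans (sym (tagged i (ℕ.m<n⇒m<1+n i<c) x∈Bi)) (tagged c ℕ.≤-refl x∈Bc)) i<c

  length-blocks : ∀ c B → + length (blocks c B) ≡ sumTo c (λ i → + length (B i))
  length-blocks zero    B = refl
  length-blocks (suc c) B = trans (cong +_ (List.length-++ (blocks c B)))
    (trans (ℤ.pos-+ (length (blocks c B)) _) (cong (_+ + length (B c)) (length-blocks c B)))

-- The y ∈ ℕᵏ with Σ y ≤ r, grouped by c = r − y₀; there are simplexSize k r = C(r + k, k) of them.
simplexPoints : (k : ℕ) → ℤ → List (Vec ℕ k)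
simplexPoints k       -[1+ _ ] = []
simplexPoints zero    (+ r)    = [] ∷ []
simplexPoints (suc k) (+ r)    = blocks (suc r) (λ c → List.map ((r ℕ.∸ c) ∷_) (simplexPoints k (+ c)))

simplexSize : ℕ → ℤ → ℤ
simplexSize k       -[1+ _ ] = + 0
simplexSize zero    (+ r)    = + 1
simplexSize (suc k) (+ r)    = sumTo (suc r) (λ c → simplexSize k (+ c))

∈-simplexPoints⁻ : ∀ k r {y} → y ∈ simplexPoints k r → + Vec.sum y ≤ r
∈-simplexPoints⁻ zero    (+ r) (here refl) = ℤ.+≤+ ℕ.z≤n
∈-simplexPoints⁻ (suc k) (+ r) y∈ with ∈-blocks⁻ (suc r) _ y∈
... | c , c<1+r , y∈c with ∈-map⁻ ((r ℕ.∸ c) ∷_) y∈c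
... | y′ , y′∈ , refl = ℤ.+≤+ (begin
  r ℕ.∸ c ℕ.+ Vec.sum y′  ≤⟨ ℕ.+-monoʳ-≤ (r ℕ.∸ c) (ℤ.drop‿+≤+ (∈-simplexPoints⁻ k (+ c) y′∈)) ⟩
  r ℕ.∸ c ℕ.+ c           ≡⟨ ℕ.m∸n+n≡m (ℕ.s≤s⁻¹ c<1+r) ⟩
  r                       ∎)
  where open ℕ.≤-Reasoning

∈-simplexPoints⁺ : ∀ k r y → + Vec.sum y ≤ r → y ∈ simplexPoints k r
∈-simplexPoints⁺ zero    (+ r) []       _ = here refl
∈-simplexPoints⁺ (suc k) (+ r) (h ∷ y′) (ℤ.+≤+ h+Σy′≤r) =
  ∈-blocks⁺ (suc r) _ (r ℕ.∸ h) (ℕ.s≤s (ℕ.m∸n≤m r h))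
    (subst (λ h′ → (h′ ∷ y′) ∈ List.map ((r ℕ.∸ (r ℕ.∸ h)) ∷_) (simplexPoints k (+ (r ℕ.∸ h))))
           (ℕ.m∸[m∸n]≡n h≤r)
           (∈-map⁺ _ (∈-simplexPoints⁺ k (+ (r ℕ.∸ h)) y′ (ℤ.+≤+ Σy′≤r∸h))))
  where
  h≤r : h ℕ.≤ r
  h≤r = ℕ.≤-trans (ℕ.m≤m+n h (Vec.sum y′)) h+Σy′≤r
  Σy′≤r∸h : Vec.sum y′ ℕ.≤ r ℕ.∸ h
  Σy′≤r∸h = subst (ℕ._≤ r ℕ.∸ h) (ℕ.m+n∸m≡n h (Vec.sum y′)) (ℕ.∸-monoˡ-≤ h h+Σy′≤r)

simplexPoints-unique : ∀ k r → Unique (simplexPoints k r)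
simplexPoints-unique k       -[1+ _ ] = []
simplexPoints-unique zero    (+ r)    = All.[] ∷ []
simplexPoints-unique (suc k) (+ r)    =
  blocks-unique (suc r) _ (λ y → r ℕ.∸ Vec.head y) tagged
    (λ c → map⁺ ∷-injectiveʳ (simplexPoints-unique k (+ c)))
  where
  ∷-injectiveʳ : ∀ {h} {y y′ : Vec ℕ k} → Vec._∷_ h y ≡ h ∷ y′ → y ≡ y′
  ∷-injectiveʳ refl = refl
  tagged : ∀ c {y} → c ℕ.< suc r → y ∈ List.map ((r ℕ.∸ c) ∷_) (simplexPoints k (+ c)) → r ℕ.∸ Vec.head y ≡ c
  tagged c c<1+r y∈ with ∈-map⁻ ((r ℕ.∸ c) ∷_) y∈
  ... | _ , _ , refl = ℕ.m∸[m∸n]≡n (ℕ.s≤s⁻¹ c<1+r)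

length-simplexPoints : ∀ k r → + length (simplexPoints k r) ≡ simplexSize k r
length-simplexPoints k       -[1+ _ ] = refl
length-simplexPoints zero    (+ r)    = refl
length-simplexPoints (suc k) (+ r)    = trans (length-blocks (suc r) _)
  (sumTo-cong (suc r) (λ c _ → trans (cong +_ (List.length-map _ (simplexPoints k (+ c)))) (length-simplexPoints k (+ c))))

module _ {D} (p : Vec ℤ D) (N : ℕ) .{{_ : NonZero N}} where

  lowest : ℕ → Vec ℤ D
  lowest s = Vec.map (λ pi → ceilDiv (pi * + s) N) p

  raise : ℕ → Vec ℕ D → Vec ℤ D
  raise s y = Vec.zipWith _+_ (Vec.map +_ y) (lowest s)

  lookup-raise : ∀ s y i → lookup (raise s y) i ≡ + lookup y i + ceilDiv (lookup p i * + s) N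
  lookup-raise s y i = trans (Vec.lookup-zipWith _+_ i (Vec.map +_ y) (lowest s))
    (cong₂ _+_ (Vec.lookup-map i +_ y) (Vec.lookup-map i (λ pi → ceilDiv (pi * + s) N) p))

  sumVecℤ-raise : ∀ s y → sumVecℤ (raise s y) ≡ + Vec.sum y + sumVecℤ (lowest s)
  sumVecℤ-raise s y = trans (sumVecℤ-zipWith-+ (Vec.map +_ y) (lowest s)) (cong (_+ sumVecℤ (lowest s)) (sumVecℤ-map-pos y))

  weight≡Σlowest+last : ∀ s → weight p N s ≡ sumVecℤ (lowest s) + ceilDiv ((+ 1 - sumVecℤ p) * + s) N
  weight≡Σlowest+last s = trans (cong sumVecℤ (Vec.map-∷ʳ (λ qi → ceilDiv (qi * + s) N) (+ 1 - sumVecℤ p) p)) (sumVecℤ-∷ʳ (lowest s) _)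

  Σy≤t-weight⇔top-facet : ∀ t s y →
    + Vec.sum y ≤ + t - weight p N s ⇔ (+ 1 - sumVecℤ p) * + s ≤ + N * (+ t - sumVecℤ (raise s y))
  Σy≤t-weight⇔top-facet t s y = begin
    + Vec.sum y ≤ + t - weight p N s                     ≡⟨ cong (λ w → + Vec.sum y ≤ + t - w) (weight≡Σlowest+last s) ⟩
    + Vec.sum y ≤ + t - (L + K)                          ≈⟨ i≤j-k⇔i+k≤j {k = L + K} ⟩
    + Vec.sum y + (L + K) ≤ + t                          ≡⟨ cong (_≤ + t) (lemma (+ Vec.sum y) L K) ⟩
    K + (+ Vec.sum y + L) ≤ + t                          ≈⟨ i≤j-k⇔i+k≤j {k = + Vec.sum y + L} ⟨
    K ≤ + t - (+ Vec.sum y + L)                          ≡⟨ cong (λ x → K ≤ + t - x) (sumVecℤ-raise s y) ⟨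
    K ≤ + t - sumVecℤ (raise s y)                        ≈⟨ ceilDiv-galois ((+ 1 - sumVecℤ p) * + s) N (+ t - sumVecℤ (raise s y)) ⟩
    (+ 1 - sumVecℤ p) * + s ≤ + N * (+ t - sumVecℤ (raise s y)) ∎
    where
    open ⇔-Reasoning
    L K : ℤ
    L = sumVecℤ (lowest s)
    K = ceilDiv ((+ 1 - sumVecℤ p) * + s) N
    lemma : ∀ y l k → y + (l + k) ≡ k + (y + l)
    lemma = solve-∀

  layer : ℕ → ℕ → List (Vec ℤ (suc D))
  layer t s = List.map (λ y → raise s y ∷ʳ + s) (simplexPoints D (+ t - weight p N s))

  dilatePoints : ℕ → List (Vec ℤ (suc D))
  dilatePoints t = blocks (suc (t ℕ.* N)) (layer t)

  raise-inDilateℤ : ∀ t s y → + Vec.sum y ≤ + t - weight p N s → InDilateℤ p N t (raise s y) (+ s)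
  raise-inDilateℤ t s y Σy≤t-w = ℤ.+≤+ ℕ.z≤n , facet , Equivalence.to (Σy≤t-weight⇔top-facet t s y) Σy≤t-w
    where
    facet : ∀ i → lookup p i * + s ≤ + N * lookup (raise s y) i
    facet i = begin
      lookup p i * + s          ≤⟨ Equivalence.to (ceilDiv-galois (lookup p i * + s) N c) ℤ.≤-refl ⟩
      + N * c                   ≤⟨ ℤ.*-monoˡ-≤-nonNeg (+ N) (ℤ.i≤j+i c (+ lookup y i)) ⟩
      + N * (+ lookup y i + c)  ≡⟨ cong (+ N *_) (lookup-raise s y i) ⟨
      + N * lookup (raise s y) i ∎
      where
      open ℤ.≤-Reasoning
      c = ceilDiv (lookup p i * + s) N

  inDilateℤ⇒raise : ∀ t xs s → InDilateℤ p N t xs (+ s) →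
    s ℕ.≤ t ℕ.* N × Σ (Vec ℕ D) λ y → + Vec.sum y ≤ + t - weight p N s × raise s y ≡ xs
  inDilateℤ⇒raise t xs s (_ , facet , top) = s≤tN , y , Σy≤t-w , raise≡xs
    where
    c : Fin D → ℤ
    c i = ceilDiv (lookup p i * + s) N
    c≤x : ∀ i → c i ≤ lookup xs i
    c≤x i = Equivalence.from (ceilDiv-galois (lookup p i * + s) N (lookup xs i)) (facet i)
    y : Vec ℕ D
    y = Vec.tabulate (λ i → ∣ lookup xs i - c i ∣)
    raise≡xs : raise s y ≡ xs
    raise≡xs = ≗⇒≡ λ i → begin
      lookup (raise s y) i       ≡⟨ lookup-raise s y i ⟩
      + lookup y i + c i         ≡⟨ cong (λ a → + a + c i) (Vec.lookup∘tabulate (λ i → ∣ lookup xs i - c i ∣) i) ⟩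
      + ∣ lookup xs i - c i ∣ + c i ≡⟨ cong (_+ c i) (ℤ.0≤i⇒+∣i∣≡i (ℤ.i≤j⇒0≤j-i (c≤x i))) ⟩
      lookup xs i - c i + c i    ≡⟨ lemma (lookup xs i) (c i) ⟩
      lookup xs i                ∎
      where
      open ≡-Reasoning
      lemma : ∀ x c → x - c + c ≡ x
      lemma = solve-∀
    Σy≤t-w : + Vec.sum y ≤ + t - weight p N s
    Σy≤t-w = Equivalence.from (Σy≤t-weight⇔top-facet t s y)
      (subst (λ x → (+ 1 - sumVecℤ p) * + s ≤ + N * (+ t - sumVecℤ x)) (sym raise≡xs) top)
    w≤t : weight p N s ≤ + t
    w≤t = ℤ.0≤i-j⇒j≤i (ℤ.≤-trans (ℤ.+≤+ ℕ.z≤n) Σy≤t-w)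
    s≤tN : s ℕ.≤ t ℕ.* N
    s≤tN = ℕ.≮⇒≥ (λ tN<s → ℤ.<⇒≱ (kN<s⇒k<weight p N t s tN<s) w≤t)

  ∈-dilatePoints⇔ℤ : ∀ t xs s → (xs ∷ʳ s) ∈ dilatePoints t ⇔ InDilateℤ p N t xs s
  ∈-dilatePoints⇔ℤ t xs s = mk⇔ to from
    where
    to : (xs ∷ʳ s) ∈ dilatePoints t → InDilateℤ p N t xs s
    to x∈ with ∈-blocks⁻ (suc (t ℕ.* N)) (layer t) x∈
    ... | s′ , _ , x∈s′ with ∈-map⁻ (λ y → raise s′ y ∷ʳ + s′) x∈s′
    ... | y , y∈ , x≡ with Vec.∷ʳ-injective xs (raise s′ y) x≡
    ... | refl , refl = raise-inDilateℤ t s′ y (∈-simplexPoints⁻ D _ y∈)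
    from : InDilateℤ p N t xs s → (xs ∷ʳ s) ∈ dilatePoints t
    from x∈@(ℤ.+≤+ {n = s′} _ , _) =
      let s′≤tN , y , Σy≤t-w , raise≡xs = inDilateℤ⇒raise t xs s′ x∈ in
      subst (λ x → (x ∷ʳ + s′) ∈ dilatePoints t) raise≡xs
        (∈-blocks⁺ (suc (t ℕ.* N)) (layer t) s′ (ℕ.s≤s s′≤tN) (∈-map⁺ _ (∈-simplexPoints⁺ D _ y Σy≤t-w)))

  dilatePoints-unique : ∀ t → Unique (dilatePoints t)
  dilatePoints-unique t = blocks-unique (suc (t ℕ.* N)) (layer t) (λ x → ∣ Vec.last x ∣) tagged
    (λ s → map⁺ (raise-injective s) (simplexPoints-unique D (+ t - weight p N s)))
    where
    tagged : ∀ s {x} → s ℕ.< suc (t ℕ.* N) → x ∈ layer t s → ∣ Vec.last x ∣ ≡ s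
    tagged s _ x∈ with ∈-map⁻ (λ y → raise s y ∷ʳ + s) x∈
    ... | y , _ , refl = cong ∣_∣ (Vec.last-∷ʳ (+ s) (raise s y))
    raise-injective : ∀ s {y y′} → raise s y ∷ʳ + s ≡ raise s y′ ∷ʳ + s → y ≡ y′
    raise-injective s {y} {y′} eq = ≗⇒≡ λ i → ℤ.+-injective (+-cancelʳ (ceilDiv (lookup p i * + s) N) _ _
      (trans (sym (lookup-raise s y i)) (trans (cong (λ v → lookup v i) (Vec.∷ʳ-injectiveˡ _ _ eq)) (lookup-raise s y′ i))))

  length-dilatePoints : ∀ t → + length (dilatePoints t) ≡ sumTo (suc (t ℕ.* N)) (λ s → simplexSize D (+ t - weight p N s))
  length-dilatePoints t = trans (length-blocks (suc (t ℕ.* N)) (layer t)) (sumTo-cong (suc (t ℕ.* N)) λ s _ →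
    trans (cong +_ (List.length-map _ (simplexPoints D (+ t - weight p N s)))) (length-simplexPoints D (+ t - weight p N s)))

  latticeCount≡ : ∀ t c → LatticeCount (InDilate t (vertΔ p (+ N))) c →
    + c ≡ sumTo (suc (t ℕ.* N)) (λ s → simplexSize D (+ t - weight p N s))
  latticeCount≡ t _ (xs , xs-unique , refl , ∈xs⇔) = trans
    (cong +_ (↭-length (∼bag⇒↭ (unique∧set⇒bag xs-unique (dilatePoints-unique t) ∈xs⇔∈dilatePoints))))
    (length-dilatePoints t)
    where
    ∈xs⇔∈dilatePoints : ∀ {x} → x ∈ xs ⇔ x ∈ dilatePoints t
    ∈xs⇔∈dilatePoints {x} with Vec.initLast x
    ... | ys , s , refl = ⇔.trans (∈xs⇔ (ys ∷ʳ s))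
      (⇔.trans (inDilate⇔inDilateℤ p N t ys s) (⇔.sym (∈-dilatePoints⇔ℤ t ys s)))

-- Finite differences

-- Backward difference with f(−1) = 0: Δ^a multiplies the series Σ f(t) xᵗ by (1 − x)^a.
Δ : (ℕ → ℤ) → ℕ → ℤ
Δ f zero    = f zero
Δ f (suc t) = f (suc t) - f t

Δ^ : ℕ → (ℕ → ℤ) → ℕ → ℤ
Δ^ zero    f = f
Δ^ (suc a) f = Δ (Δ^ a f)

Δ-cong : ∀ {f g : ℕ → ℤ} → (∀ t → f t ≡ g t) → ∀ t → Δ f t ≡ Δ g t
Δ-cong e zero    = e zero
Δ-cong e (suc t) = cong₂ _-_ (e (suc t)) (e t)

Δ^-cong : ∀ a {f g : ℕ → ℤ} → (∀ t → f t ≡ g t) → ∀ t → Δ^ a f t ≡ Δ^ a g t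
Δ^-cong zero    e = e
Δ^-cong (suc a) e = Δ-cong (Δ^-cong a e)

Δ^-suc : ∀ a f t → Δ^ (suc a) f t ≡ Δ^ a (Δ f) t
Δ^-suc zero    f t = refl
Δ^-suc (suc a) f t = Δ-cong (Δ^-suc a f) t

Δ^-local : ∀ a {f g : ℕ → ℤ} k → (∀ t → t ℕ.≤ k → f t ≡ g t) → Δ^ a f k ≡ Δ^ a g k
Δ^-local zero    k       e = e k ℕ.≤-refl
Δ^-local (suc a) zero    e = Δ^-local a zero e
Δ^-local (suc a) (suc k) e = cong₂ _-_ (Δ^-local a (suc k) e) (Δ^-local a k (λ t t≤k → e t (ℕ.m≤n⇒m≤1+n t≤k)))

Δ^-sumTo : ∀ a c (h : ℕ → ℕ → ℤ) t → Δ^ a (λ t → sumTo c (λ s → h s t)) t ≡ sumTo c (λ s → Δ^ a (h s) t)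
Δ^-sumTo zero    c h t = refl
Δ^-sumTo (suc a) c h t = trans (Δ-cong (Δ^-sumTo a c h) t) (Δ-sumTo t)
  where
  Δ-sumTo : ∀ t → Δ (λ t → sumTo c (λ s → Δ^ a (h s) t)) t ≡ sumTo c (λ s → Δ (Δ^ a (h s)) t)
  Δ-sumTo zero    = refl
  Δ-sumTo (suc t) = sym (sumTo-sub c (λ s → Δ^ a (h s) (suc t)) (λ s → Δ^ a (h s) t))

binomialSum : ℕ → (ℕ → ℤ) → ℕ → ℤ
binomialSum a f k = sumTo (suc k) (λ j → sgn j * + (a C j) * f (k ℕ.∸ j))

binomialSum-0 : ∀ f k → binomialSum 0 f k ≡ f k
binomialSum-0 f k = begin
  binomialSum 0 f k                                                  ≡⟨ sumTo-shift k _ ⟩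
  + 1 * + 1 * f k + sumTo k (λ j → sgn (suc j) * + 0 * f (k ℕ.∸ suc j)) ≡⟨ cong (_+_ (+ 1 * + 1 * f k)) (sumTo-≗0 k zeros) ⟩
  + 1 * + 1 * f k + + 0                                              ≡⟨ lemma₂ (f k) ⟩
  f k                                                                ∎
  where
  open ≡-Reasoning
  zeros : ∀ j → j ℕ.< k → sgn (suc j) * + 0 * f (k ℕ.∸ suc j) ≡ + 0
  zeros j _ = lemma₁ (sgn (suc j)) (f (k ℕ.∸ suc j))
    where lemma₁ : ∀ a b → a * + 0 * b ≡ + 0
          lemma₁ = solve-∀
  lemma₂ : ∀ a → + 1 * + 1 * a + + 0 ≡ a
  lemma₂ = solve-∀

binomialSum-suc : ∀ a f k → binomialSum (suc a) f k ≡ Δ (binomialSum a f) k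
binomialSum-suc a f zero    = refl
binomialSum-suc a f (suc k) = begin
  binomialSum (suc a) f (suc k)
    ≡⟨ sumTo-shift (suc k) _ ⟩
  u 0 * f (suc k) + sumTo (suc k) (λ j → u′ (suc j) * f (k ℕ.∸ j))
    ≡⟨ cong (_+_ (u 0 * f (suc k))) (sumTo-cong (suc k) (λ j _ → pascal j)) ⟩
  u 0 * f (suc k) + sumTo (suc k) (λ j → u (suc j) * f (k ℕ.∸ j) - u j * f (k ℕ.∸ j))
    ≡⟨ cong (_+_ (u 0 * f (suc k))) (sumTo-sub (suc k) _ _) ⟩
  u 0 * f (suc k) + (sumTo (suc k) (λ j → u (suc j) * f (k ℕ.∸ j)) - binomialSum a f k)
    ≡⟨ ℤ.+-assoc (u 0 * f (suc k)) _ _ ⟨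
  u 0 * f (suc k) + sumTo (suc k) (λ j → u (suc j) * f (k ℕ.∸ j)) - binomialSum a f k
    ≡⟨ cong (_- binomialSum a f k) (sumTo-shift (suc k) (λ j → u j * f (suc k ℕ.∸ j))) ⟨
  binomialSum a f (suc k) - binomialSum a f k
    ∎
  where
  open ≡-Reasoning
  u u′ : ℕ → ℤ
  u  j = sgn j * + (a C j)
  u′ j = sgn j * + (suc a C j)
  pascal : ∀ j → u′ (suc j) * f (k ℕ.∸ j) ≡ u (suc j) * f (k ℕ.∸ j) - u j * f (k ℕ.∸ j)
  pascal j = begin
    - sgn j * + (suc a C suc j) * f (k ℕ.∸ j)
      ≡⟨ cong (λ c → - sgn j * + c * f (k ℕ.∸ j)) (nCk+nC[k+1]≡[n+1]C[k+1] a j) ⟨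
    - sgn j * + (a C j ℕ.+ a C suc j) * f (k ℕ.∸ j)
      ≡⟨ cong (λ c → - sgn j * c * f (k ℕ.∸ j)) (ℤ.pos-+ (a C j) (a C suc j)) ⟩
    - sgn j * (+ (a C j) + + (a C suc j)) * f (k ℕ.∸ j)
      ≡⟨ lemma (sgn j) (+ (a C j)) (+ (a C suc j)) (f (k ℕ.∸ j)) ⟩
    - sgn j * + (a C suc j) * f (k ℕ.∸ j) - sgn j * + (a C j) * f (k ℕ.∸ j)
      ∎
    where lemma : ∀ s x y F → - s * (x + y) * F ≡ - s * y * F - s * x * F
          lemma = solve-∀

binomialSum≡Δ^ : ∀ a f k → binomialSum a f k ≡ Δ^ a f k
binomialSum≡Δ^ zero    f k = binomialSum-0 f k
binomialSum≡Δ^ (suc a) f k = trans (binomialSum-suc a f k) (Δ-cong (binomialSum≡Δ^ a f) k)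

δ : ℤ → ℤ → ℤ
δ a b = if does (a ℤ.≟ b) then + 1 else + 0

δ-≡ : ∀ {a b} → a ≡ b → δ a b ≡ + 1
δ-≡ {a} {b} a≡b rewrite dec-true (a ℤ.≟ b) a≡b = refl

δ-≢ : ∀ {a b} → a ≢ b → δ a b ≡ + 0
δ-≢ {a} {b} a≢b rewrite dec-false (a ℤ.≟ b) a≢b = refl

δ-+ : ∀ a b c → δ (a + c) (b + c) ≡ δ a b
δ-+ a b c with a ℤ.≟ b
... | yes a≡b = δ-≡ {a + c} {b + c} (cong (_+ c) a≡b)
... | no  a≢b = δ-≢ {a + c} {b + c} (λ a+c≡b+c → a≢b (+-cancelʳ c a b a+c≡b+c))

simplexSize-0 : ∀ k → simplexSize k (+ 0) ≡ + 1
simplexSize-0 zero    = refl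
simplexSize-0 (suc k) = trans (ℤ.+-identityˡ _) (simplexSize-0 k)

simplexSize-neg : ∀ k {r} → r < + 0 → simplexSize k r ≡ + 0
simplexSize-neg k { -[1+ _ ]} _          = refl
simplexSize-neg k {+ _}      (ℤ.+<+ ())

simplexSize-0-nonneg : ∀ {r} → + 0 ≤ r → simplexSize 0 r ≡ + 1
simplexSize-0-nonneg {+ _} _ = refl

simplexSize-suc : ∀ k r → simplexSize (suc k) (r + + 1) - simplexSize (suc k) r ≡ simplexSize k (r + + 1)
simplexSize-suc k (+ n) rewrite sym (ℤ.pos-+ n 1) | ℕ.+-comm n 1 =
  lemma (simplexSize (suc k) (+ n)) (simplexSize k (+ suc n))
  where lemma : ∀ a b → a + b - a ≡ b
        lemma = solve-∀
simplexSize-suc k -[1+ zero ]  = trans (ℤ.+-identityʳ _) (trans (simplexSize-0 (suc k)) (sym (simplexSize-0 k)))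
simplexSize-suc k -[1+ suc n ] = refl

Δ-simplexSize : ∀ w k t → Δ (λ t → simplexSize (suc k) (+ t - + w)) t ≡ simplexSize k (+ t - + w)
Δ-simplexSize w k zero with w
... | zero  = trans (simplexSize-0 (suc k)) (sym (simplexSize-0 k))
... | suc _ = refl
Δ-simplexSize w k (suc t) = trans (cong (λ r → simplexSize (suc k) r - simplexSize (suc k) (+ t - + w)) t+1-w)
  (trans (simplexSize-suc k (+ t - + w)) (cong (simplexSize k) (sym t+1-w)))
  where
  t+1-w : + suc t - + w ≡ + t - + w + + 1
  t+1-w = lemma (+ t) (+ w)
    where lemma : ∀ t w → + 1 + t - w ≡ t - w + + 1
          lemma = solve-∀

Δ^-simplexSize : ∀ w k t → Δ^ k (λ t → simplexSize k (+ t - + w)) t ≡ simplexSize 0 (+ t - + w)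
Δ^-simplexSize w zero    t = refl
Δ^-simplexSize w (suc k) t = trans (Δ^-suc k _ t) (trans (Δ^-cong k (Δ-simplexSize w k) t) (Δ^-simplexSize w k t))

w≤t⇒simplexSize-0≡1 : ∀ {w t} → w ℕ.≤ t → simplexSize 0 (+ t - + w) ≡ + 1
w≤t⇒simplexSize-0≡1 w≤t = simplexSize-0-nonneg (ℤ.i≤j⇒0≤j-i (ℤ.+≤+ w≤t))

t<w⇒simplexSize-0≡0 : ∀ {w t} → t ℕ.< w → simplexSize 0 (+ t - + w) ≡ + 0
t<w⇒simplexSize-0≡0 t<w = simplexSize-neg 0 (i<j⇒i-j<0 (ℤ.+<+ t<w))

Δ-simplexSize-0 : ∀ w t → Δ (λ t → simplexSize 0 (+ t - + w)) t ≡ δ (+ w) (+ t)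
Δ-simplexSize-0 w zero with w
... | zero  = refl
... | suc _ = refl
Δ-simplexSize-0 w (suc t) with ℕ.<-cmp w (suc t)
... | tri< w<1+t w≢1+t _ = trans (cong₂ _-_ (w≤t⇒simplexSize-0≡1 {w} {suc t} (ℕ.<⇒≤ w<1+t)) (w≤t⇒simplexSize-0≡1 {w} {t} (ℕ.s≤s⁻¹ w<1+t)))
                                  (sym (δ-≢ (λ w≡1+t → w≢1+t (ℤ.+-injective w≡1+t))))
... | tri≈ _ refl _      = trans (cong₂ _-_ (w≤t⇒simplexSize-0≡1 {w} {w} ℕ.≤-refl) (t<w⇒simplexSize-0≡0 {w} {t} ℕ.≤-refl)) (sym (δ-≡ {+ w} {+ w} refl))
... | tri> _ w≢1+t 1+t<w = trans (cong₂ _-_ (t<w⇒simplexSize-0≡0 {w} {suc t} 1+t<w) (t<w⇒simplexSize-0≡0 {w} {t} (ℕ.<⇒≤ 1+t<w)))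
                                  (sym (δ-≢ (λ w≡1+t → w≢1+t (ℤ.+-injective w≡1+t))))

Δ^[2+k]-simplexSize : ∀ w k t → Δ^ (suc (suc k)) (λ t → simplexSize k (+ t - + w)) t ≡ Δ (λ t → δ (+ w) (+ t)) t
Δ^[2+k]-simplexSize w k = Δ-cong (λ t → trans (Δ-cong (Δ^-simplexSize w k) t) (Δ-simplexSize-0 w t))

-- The h*-polynomial of Δ(0,p)

module _ {D} (p : Vec ℤ D) (N : ℕ) .{{_ : NonZero N}} where

  δ-weight-beyond : ∀ k s → k ℕ.* N ℕ.< s → δ (weight p N s) (+ k) ≡ + 0
  δ-weight-beyond k s kN<s = δ-≢ (λ w≡k → ℤ.<-irrefl (sym w≡k) (kN<s⇒k<weight p N k s kN<s))

  -- The term −δ(weight s, k) of layer s cancels the term δ(weight (s + N), k + 1) of layer s + N.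
  sumTo-Δδ-weight : ∀ k → sumTo (suc (k ℕ.* N)) (λ s → Δ (λ t → δ (weight p N s) (+ t)) k) ≡ monoSumCoeff N (weight p N) (+ k)
  sumTo-Δδ-weight zero = sumTo-extend _ (ℕ.>-nonZero⁻¹ N) (λ s 1≤s _ → δ-weight-beyond 0 s 1≤s)
  sumTo-Δδ-weight (suc k) = begin
    sumTo (suc B) (λ s → g s - δ (weight p N s) (+ k))                      ≡⟨ sumTo-sub (suc B) g _ ⟩
    sumTo (suc B) g - sumTo (suc B) (λ s → δ (weight p N s) (+ k))          ≡⟨ cong₂ _-_ (sumTo-extend g (ℕ.m≤n+m (suc B) N) beyond)
                                                                                           (sumTo-cong (suc B) (λ s _ → shifted s)) ⟩
    sumTo (N ℕ.+ suc B) g - sumTo (suc B) (λ s → g (N ℕ.+ s))              ≡⟨ cong (_- sumTo (suc B) (λ s → g (N ℕ.+ s))) (sumTo-+ N (suc B) g) ⟩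
    sumTo N g + sumTo (suc B) (λ s → g (N ℕ.+ s)) - sumTo (suc B) (λ s → g (N ℕ.+ s)) ≡⟨ lemma (sumTo N g) _ ⟩
    sumTo N g                                                               ∎
    where
    open ≡-Reasoning
    B : ℕ
    B = suc k ℕ.* N
    g : ℕ → ℤ
    g s = δ (weight p N s) (+ suc k)
    beyond : ∀ s → suc B ℕ.≤ s → s ℕ.< N ℕ.+ suc B → g s ≡ + 0
    beyond s B<s _ = δ-weight-beyond (suc k) s B<s
    shifted : ∀ s → δ (weight p N s) (+ k) ≡ g (N ℕ.+ s)
    shifted s = sym (trans (cong₂ δ (trans (cong (weight p N) (ℕ.+-comm N s)) (weight-+N p N s)) +[1+k]≡+k+1)
                           (δ-+ (weight p N s) (+ k) (+ 1)))
      where +[1+k]≡+k+1 : + suc k ≡ + k + + 1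
            +[1+k]≡+k+1 = trans (cong +_ (ℕ.+-comm 1 k)) (ℤ.pos-+ k 1)
    lemma : ∀ a b → a + b - b ≡ a
    lemma = solve-∀

  module _ (E : ℕ → ℕ) (E-counts : ∀ t → 1 ℕ.≤ t → LatticeCount (InDilate t (vertΔ p (+ N))) (E t)) where

    ehrSeq≡ : ∀ t → ehrSeq E t ≡ sumTo (suc (t ℕ.* N)) (λ s → simplexSize D (+ t - weight p N s))
    ehrSeq≡ zero    = sym (trans (ℤ.+-identityˡ _)
      (trans (cong (λ w → simplexSize D (+ 0 - w)) (weight-0 p N)) (simplexSize-0 D)))
    ehrSeq≡ (suc t) = latticeCount≡ p N (suc t) (E (suc t)) (E-counts (suc t) (ℕ.s≤s ℕ.z≤n))

    ehrSeq≡-upto : ∀ k t → t ℕ.≤ k → ehrSeq E t ≡ sumTo (suc (k ℕ.* N)) (λ s → simplexSize D (+ t - weight p N s))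
    ehrSeq≡-upto k t t≤k = trans (ehrSeq≡ t) (sumTo-extend _ (ℕ.s≤s (ℕ.*-monoˡ-≤ N t≤k))
      (λ s tN<s _ → simplexSize-neg D (i<j⇒i-j<0 (kN<s⇒k<weight p N t s tN<s))))

    Δ^[2+D]-layerSize : ∀ k s → Δ^ (suc (suc D)) (λ t → simplexSize D (+ t - weight p N s)) k ≡ Δ (λ t → δ (weight p N s) (+ t)) k
    Δ^[2+D]-layerSize k s = begin
      Δ^ (suc (suc D)) (λ t → simplexSize D (+ t - weight p N s)) k ≡⟨ Δ^-cong (suc (suc D)) (λ t → cong (λ w → simplexSize D (+ t - w)) w≡) k ⟩
      Δ^ (suc (suc D)) (λ t → simplexSize D (+ t - + ∣ weight p N s ∣)) k ≡⟨ Δ^[2+k]-simplexSize ∣ weight p N s ∣ D k ⟩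
      Δ (λ t → δ (+ ∣ weight p N s ∣) (+ t)) k                        ≡⟨ Δ-cong (λ t → cong (λ w → δ w (+ t)) w≡) k ⟨
      Δ (λ t → δ (weight p N s) (+ t)) k                              ∎
      where
      open ≡-Reasoning
      w≡ : weight p N s ≡ + ∣ weight p N s ∣
      w≡ = sym (ℤ.0≤i⇒+∣i∣≡i (weight-nonneg p N s))

    hstarCoeff≡monoSumCoeff-weight : ∀ k → hstarCoeff (suc D) E k ≡ monoSumCoeff N (weight p N) k
    hstarCoeff≡monoSumCoeff-weight -[1+ k ] = sym (sumTo-≗0 N (λ s _ → δ-≢ λ w≡ → +0≰-[1+n] (subst (+ 0 ≤_) w≡ (weight-nonneg p N s))))
      where +0≰-[1+n] : ¬ (+ 0 ≤ -[1+ k ])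
            +0≰-[1+n] ()
    hstarCoeff≡monoSumCoeff-weight (+ k) = begin
      hstarCoeff (suc D) E (+ k)                                        ≡⟨ binomialSum≡Δ^ (suc (suc D)) (ehrSeq E) k ⟩
      Δ^ (suc (suc D)) (ehrSeq E) k                                     ≡⟨ Δ^-local (suc (suc D)) k (ehrSeq≡-upto k) ⟩
      Δ^ (suc (suc D)) (λ t → sumTo (suc (k ℕ.* N)) (layerSize t)) k    ≡⟨ Δ^-sumTo (suc (suc D)) (suc (k ℕ.* N)) (λ s t → layerSize t s) k ⟩
      sumTo (suc (k ℕ.* N)) (λ s → Δ^ (suc (suc D)) (λ t → layerSize t s) k) ≡⟨ sumTo-cong (suc (k ℕ.* N)) (λ s _ → Δ^[2+D]-layerSize k s) ⟩
      sumTo (suc (k ℕ.* N)) (λ s → Δ (λ t → δ (weight p N s) (+ t)) k)  ≡⟨ sumTo-Δδ-weight k ⟩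
      monoSumCoeff N (weight p N) (+ k)                                 ∎
      where
      open ≡-Reasoning
      layerSize : ℕ → ℕ → ℤ
      layerSize t s = simplexSize D (+ t - weight p N s)

-- The dilations q⁽ᵐ⁾

module _ {D} (q : Vec ℤ D) (m n : ℕ) .{{_ : NonZero n}} (q∣n : ∀ i → lookup (qFull q) i ∣ + n) where
  private instance
    m*n≢0 : NonZero (suc m ℕ.* n)
    m*n≢0 = ℕ.m*n≢0 (suc m) n

  monoSumCoeff-weight-residues : ∀ k →
    monoSumCoeff (suc m ℕ.* n) (weight q (suc m ℕ.* n)) k ≡ monoSumCoeff n (weight q n) k + + m * monoSumCoeff n (expo q n) k
  monoSumCoeff-weight-residues k = begin
    sumTo (suc m ℕ.* n) a                                         ≡⟨ cong (λ c → sumTo c a) (ℕ.*-comm (suc m) n) ⟩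
    sumTo (n ℕ.* suc m) a                                         ≡⟨ sumTo-* n (suc m) a ⟩
    sumTo n (λ j → sumTo (suc m) (λ b → a (j ℕ.* suc m ℕ.+ b)))  ≡⟨ sumTo-cong n (λ j _ → residues j) ⟩
    sumTo n (λ j → δ (weight q n j) k + + m * δ (expo q n j) k)  ≡⟨ sumTo-+-distrib n _ _ ⟩
    monoSumCoeff n (weight q n) k + sumTo n (λ j → + m * δ (expo q n j) k) ≡⟨ cong (_+_ (monoSumCoeff n (weight q n) k)) (sumTo-*ˡ n (+ m) _) ⟩
    monoSumCoeff n (weight q n) k + + m * monoSumCoeff n (expo q n) k ∎
    where
    open ≡-Reasoning
    a : ℕ → ℤ
    a s = δ (weight q (suc m ℕ.* n) s) k
    residues : ∀ j → sumTo (suc m) (λ b → a (j ℕ.* suc m ℕ.+ b)) ≡ δ (weight q n j) k + + m * δ (expo q n j) k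
    residues j = trans (sumTo-shift m _) (cong₂ _+_
      (cong (λ s → δ s k) (trans (cong (weight q (suc m ℕ.* n)) (ℕ.+-identityʳ (j ℕ.* suc m))) (weight-multiple q m n j)))
      (trans (sumTo-cong m (λ b b<m → cong (λ s → δ s k) (weight-interior q m n q∣n j (suc b) ℕ.z<s (ℕ.s≤s b<m))))
             (sumTo-const m _)))

Poly-cong : ∀ {A B : ℤ → ℤ} → (∀ k → A k ≡ B k) → Poly A → Poly B
Poly-cong A≗B ((bound , vanish) , nonneg) =
  (bound , λ k <∣k∣ → trans (sym (A≗B k)) (vanish k <∣k∣)) , λ k k<0 → trans (sym (A≗B k)) (nonneg k k<0)

Poly-sub : ∀ {A B : ℤ → ℤ} → Poly A → Poly B → Poly (λ k → A k - B k)
Poly-sub ((a , A-vanish) , A-nonneg) ((b , B-vanish) , B-nonneg) =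
  (a ℕ.⊔ b , λ k <∣k∣ → cong₂ _-_ (A-vanish k (ℕ.≤-<-trans (ℕ.m≤m⊔n a b) <∣k∣)) (B-vanish k (ℕ.≤-<-trans (ℕ.m≤n⊔m a b) <∣k∣))) ,
  λ k k<0 → cong₂ _-_ (A-nonneg k k<0) (B-nonneg k k<0)

monoSumCoeff-poly : ∀ n e → (∀ j → + 0 ≤ e j) → Poly (monoSumCoeff n e)
monoSumCoeff-poly n e 0≤e = finSupp n , λ k k<0 → sumTo-≗0 n (λ j _ → δ-≢ (λ e≡k → ℤ.<⇒≱ k<0 (subst (+ 0 ≤_) e≡k (0≤e j))))
  where
  finSupp : ∀ n → FinSupp (monoSumCoeff n e)
  finSupp zero    = 0 , λ _ _ → refl
  finSupp (suc n) = let b , vanish = finSupp n in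
    b ℕ.⊔ ∣ e n ∣ , λ k <∣k∣ → cong₂ _+_ (vanish k (ℕ.≤-<-trans (ℕ.m≤m⊔n b _) <∣k∣))
      (δ-≢ {e n} {k} λ e≡k → ℕ.<-irrefl (cong ∣_∣ e≡k) (ℕ.≤-<-trans (ℕ.m≤n⊔m b _) <∣k∣))

affine-unique : ∀ {H : ℕ → ℤ} {a b a′ b′} → (∀ m → 1 ℕ.≤ m → H m ≡ + m * a + b) → (∀ m → 1 ℕ.≤ m → H m ≡ + m * a′ + b′) →
  a ≡ a′ × b ≡ b′
affine-unique {H} {a} {b} {a′} {b′} H≡ H≡′ = a≡a′ , b≡b′
  where
  slope : ∀ a b → a ≡ (+ 2 * a + b) - (+ 1 * a + b)
  slope = solve-∀
  intercept : ∀ a b → b ≡ (+ 1 * a + b) - a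
  intercept = solve-∀
  a≡a′ : a ≡ a′
  a≡a′ = begin
    a                               ≡⟨ slope a b ⟩
    (+ 2 * a + b) - (+ 1 * a + b)   ≡⟨ cong₂ _-_ (sym (H≡ 2 (ℕ.s≤s ℕ.z≤n))) (sym (H≡ 1 ℕ.≤-refl)) ⟩
    H 2 - H 1                       ≡⟨ cong₂ _-_ (H≡′ 2 (ℕ.s≤s ℕ.z≤n)) (H≡′ 1 ℕ.≤-refl) ⟩
    (+ 2 * a′ + b′) - (+ 1 * a′ + b′) ≡⟨ slope a′ b′ ⟨
    a′                              ∎
    where open ≡-Reasoning
  b≡b′ : b ≡ b′
  b≡b′ = begin
    b                    ≡⟨ intercept a b ⟩
    (+ 1 * a + b) - a    ≡⟨ cong₂ _-_ (trans (sym (H≡ 1 ℕ.≤-refl)) (H≡′ 1 ℕ.≤-refl)) a≡a′ ⟩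
    (+ 1 * a′ + b′) - a′ ≡⟨ intercept a′ b′ ⟨
    b′                   ∎
    where open ≡-Reasoning

mxAplusB-unique : ∀ {H : ℕ → ℤ → ℤ} {A B A′ B′ : ℤ → ℤ} →
  (∀ m → 1 ℕ.≤ m → ∀ k → H m k ≡ mxAplusB m A B k) → (∀ m → 1 ℕ.≤ m → ∀ k → H m k ≡ mxAplusB m A′ B′ k) →
  (∀ k → A k ≡ A′ k) × (∀ k → B k ≡ B′ k)
mxAplusB-unique {A = A} {B} {A′} {B′} H≡ H≡′ =
  (λ k → subst (λ k′ → A k′ ≡ A′ k′) (lemma k) (proj₁ (coefficients (k + + 1)))) , (λ k → proj₂ (coefficients k))
  where
  coefficients : ∀ k → A (k - + 1) ≡ A′ (k - + 1) × B k ≡ B′ k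
  coefficients k = affine-unique (λ m 1≤m → H≡ m 1≤m k) (λ m 1≤m → H≡′ m 1≤m k)
  lemma : ∀ k → k + + 1 - + 1 ≡ k
  lemma = solve-∀

Poly-L₁ : ∀ {D} (q : Vec ℤ D) n .{{_ : NonZero n}} → (∀ i → lookup (qFull q) i ∣ + n) → Poly (L₁ q n)
Poly-L₁ q n q∣n = monoSumCoeff-poly n _ (λ j → ℤ.i≤j⇒0≤j-i (ℤ.i<j⇒suc[i]≤j (expo-positive q n q∣n j)))

L₁-shift : ∀ {D} (q : Vec ℤ D) n .{{_ : NonZero n}} k → L₁ q n (k - + 1) ≡ monoSumCoeff n (expo q n) k
L₁-shift q n k = sumTo-cong n (λ j _ → δ-+ (expo q n j) k (- + 1))

module _ {D} (q : Vec ℤ D) (n : ℕ) .{{_ : NonZero n}} (q∣n : ∀ i → lookup (qFull q) i ∣ + n) (E : ℕ → ℕ → ℕ)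
         (E-counts : ∀ m t → 1 ℕ.≤ m → 1 ℕ.≤ t → LatticeCount (InDilate t (vertΔ q (+ (m ℕ.* n)))) (E m t)) where

  hstarCoeff-q⁽¹⁺ᵐ⁾ : ∀ m k →
    hstarCoeff (suc D) (E (suc m)) k ≡ monoSumCoeff n (weight q n) k + + m * monoSumCoeff n (expo q n) k
  hstarCoeff-q⁽¹⁺ᵐ⁾ m k = trans
    (hstarCoeff≡monoSumCoeff-weight q (suc m ℕ.* n) {{ℕ.m*n≢0 (suc m) n}} (E (suc m)) (λ t → E-counts (suc m) t (ℕ.s≤s ℕ.z≤n)) k)
    (monoSumCoeff-weight-residues q m n q∣n k)

  L₂≡ : ∀ k → L₂ q n (hstarCoeff (suc D) (E 1)) k ≡ monoSumCoeff n (weight q n) k - monoSumCoeff n (expo q n) k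
  L₂≡ k = cong (_- monoSumCoeff n (expo q n) k) (trans (hstarCoeff-q⁽¹⁺ᵐ⁾ 0 k) (lemma (monoSumCoeff n (weight q n) k) (monoSumCoeff n (expo q n) k)))
    where lemma : ∀ y x → y + + 0 * x ≡ y
          lemma = solve-∀

  Poly-L₂ : Poly (L₂ q n (hstarCoeff (suc D) (E 1)))
  Poly-L₂ = Poly-cong (λ k → sym (L₂≡ k))
    (Poly-sub (monoSumCoeff-poly n _ (weight-nonneg q n)) (monoSumCoeff-poly n _ (λ j → ℤ.<⇒≤ (expo-positive q n q∣n j))))

  hstarCoeff≡mxAplusB : ∀ m → 1 ℕ.≤ m → ∀ k →
    hstarCoeff (suc D) (E m) k ≡ mxAplusB m (L₁ q n) (L₂ q n (hstarCoeff (suc D) (E 1))) k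
  hstarCoeff≡mxAplusB (suc m) _ k = begin
    hstarCoeff (suc D) (E (suc m)) k     ≡⟨ hstarCoeff-q⁽¹⁺ᵐ⁾ m k ⟩
    Y + + m * X                          ≡⟨ lemma Y X (+ m) ⟩
    + suc m * X + (Y - X)                ≡⟨ cong₂ (λ l₁ l₂ → + suc m * l₁ + l₂) (L₁-shift q n k) (L₂≡ k) ⟨
    + suc m * L₁ q n (k - + 1) + L₂ q n (hstarCoeff (suc D) (E 1)) k ∎
    where
    open ≡-Reasoning
    X Y : ℤ
    X = monoSumCoeff n (expo q n) k
    Y = monoSumCoeff n (weight q n) k
    lemma : ∀ y x m → y + m * x ≡ (+ 1 + m) * x + (y - x)
    lemma = solve-∀

theorem5p1 : (d' : ℕ) (n : ℕ) .{{_ : NonZero n}} (q : Vec ℤ d') →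
    (∀ (i : Fin (suc d')) → lookup (qFull q) i ∣ + n) →
    (E : ℕ → ℕ → ℕ) →
    (∀ m t → 1 ℕ.≤ m → 1 ℕ.≤ t → LatticeCount (InDilate t (vertΔ q (+ (m ℕ.* n)))) (E m t)) →
    Poly (L₁ q n) × Poly (L₂ q n (hstarCoeff (suc d') (E 1))) ×
    (∀ m → 1 ℕ.≤ m → ∀ k → hstarCoeff (suc d') (E m) k
    ≡ mxAplusB m (L₁ q n) (L₂ q n (hstarCoeff (suc d') (E 1))) k) ×
    (∀ (A B : ℤ → ℤ) → Poly A → Poly B →
    (∀ m → 1 ℕ.≤ m → ∀ k → hstarCoeff (suc d') (E m) k ≡ mxAplusB m A B k) →
    (∀ k → A k ≡ L₁ q n k) × (∀ k → B k ≡ L₂ q n (hstarCoeff (suc d') (E 1)) k))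
theorem5p1 d' n q q∣n E E-counts =
  Poly-L₁ q n q∣n , Poly-L₂ q n q∣n E E-counts , hstarCoeff≡mxAplusB q n q∣n E E-counts ,
  -- Uniqueness holds among all coefficient functions.
  λ A B _ _ H≡ → mxAplusB-unique H≡ (hstarCoeff≡mxAplusB q n q∣n E E-counts)
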